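{- For every $n\ge 0$ there is a bijection $\Psi:\mathfrak{S}_n\rightarrow\mathcal{W}_n$ such that a permutation $\sigma\in\mathfrak{S}_n$ with $i$ inversions, $j$ fixed points, $k$ excedances and depth $\ell$ is carried to a weighted 3-colored Motzkin path $\mu\in\mathcal{W}_n$ with weight $\omega(\mu)=q^{i}p^{j}s^{k}t^{\ell}$. Consequently, \[ \sum_{n\ge 0}\left(\sum_{\sigma\in\mathfrak{S}_n} q^{\mathsf{inv}(\sigma)} p^{\mathsf{fix}(\sigma)} s^{\mathsf{exc}(\sigma)} t^{\mathsf{depth}(\sigma)}\right)z^n=\mathfrak{F}(\gamma_h,\lambda_h) \] with $\lambda_{h} = s\,[h]_q^2\,(qt)^{2h-1}$ for $h\ge1$ and $\gamma_h = \big((1+s)[h]_q+pq^h\big)(qt)^h$ for $h\ge 0$.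
   Context: $\mathfrak{S}_n$ is the symmetric group of permutations $\sigma=\sigma(1)\cdots\sigma(n)$ of $[n]=\{1,\dots,n\}$. An inversion of $\sigma$ is a pair $(i,j)$ with $1\le i<j\le n$ and $\sigma(i)>\sigma(j)$; $\mathsf{inv}(\sigma)$ is the number of inversions. An index $i$ is an excedance if $\sigma(i)>i$ and a fixed point if $\sigma(i)=i$; $\mathsf{exc}(\sigma)$ and $\mathsf{fix}(\sigma)$ count them. The depth is $\mathsf{depth}(\sigma)=\sum_{i:\sigma(i)>i}(\sigma(i)-i)$. For $k\ge1$, $[k]_q=1+q+\cdots+q^{k-1}$, and $[0]_q=0$. A Motzkin path of length $n$ is a lattice path from $(0,0)$ to $(n,0)$ staying weakly above the $x$-axis, with up steps $U=(1,1)$, down steps $D=(1,-1)$ and horizontal steps $(1,0)$. A 3-colored Motzkin path has three kinds of horizontal steps $H_1,H_2,H_3$. The height of a step is the maximum $y$-coordinate it attains; $x^{(h)}$ denotes a step of type $x$ at height $h$. $\mathcal{W}_n$ is the set of 3-colored Motzkin paths of length $n$ together with an assignment to each step of a weight $\omega$ from the following allowed sets: $\omega(H_3^{(0)})=p$; for $h\ge1$: $\omega(U^{(h)})\in\{st^{2h-1}q^{a}:0\le a\le h-1\}$, $\omega(D^{(h)})\in\{q^{2h-1+a}:0\le a\le h-1\}$, $\omega(H_1^{(h)})\in\{st^hq^{h+a}:0\le a\le h-1\}$, $\omega(H_2^{(h)})\in\{t^hq^{h+a}:0\le a\le h-1\}$, $\omega(H_3^{(h)})=pt^hq^{2h}$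 (in particular steps $H_1,H_2$ at height $0$ do not occur). The weight $\omega(\mu)$ of $\mu\in\mathcal{W}_n$ is the product of the weights of its steps. For sequences $\{\gamma_h\}_{h\ge0}$, $\{\lambda_h\}_{h\ge1}$, $\mathfrak{F}(\gamma_h,\lambda_h)$ denotes the formal power series in $z$ given by the Jacobi continued fraction \[ \mathfrak{F}(\gamma_h,\lambda_h)=\cfrac{1}{1-\gamma_0 z-\cfrac{\lambda_1 z^2}{1-\gamma_1 z-\cfrac{\lambda_2 z^2}{1-\gamma_2 z-\cdots}}}. \] -}

module Defs where

open import Level using (0ℓ)
open import Data.Bool.ListAction using ()
open import Data.Bool using (Bool; true; false; _∧_; _∨_; not; if_then_else_; T)
open import Data.Nat using (ℕ; zero; suc; _+_; _*_; _∸_; _<ᵇ_; _≡ᵇ_)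
open import Data.Fin using (Fin; toℕ)
open import Data.Vec using (Vec; []; _∷_; lookup; toList; _∷ʳ_)
open import Data.List using (List; []; _∷_; concatMap; filter; map; foldr; allFin)
open import Data.Product using (Σ; _×_; _,_)
open import Algebra.Bundles using (CommutativeSemiring)
open import Relation.Nullary.Decidable using (yes; no)

sumℕ : (n : ℕ) → (ℕ → ℕ) → ℕ
sumℕ zero    f = 0
sumℕ (suc n) f = sumℕ n f + f n

sumFin : (n : ℕ) → (Fin n → ℕ) → ℕ
sumFin n f = foldr (λ i acc → f i + acc) 0 (allFin n)

[_]ᵇ : Bool → ℕ
[ true ]ᵇ  = 1
[ false ]ᵇ = 0

-- Permutations of [n], written as words σ(1)⋯σ(n)
-- (positions and values are Fin n, i.e. 0-based; this does not affect
--  inv, fix, exc or depth, which only use comparisons and differences)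

isPermᵇ : {n : ℕ} → Vec (Fin n) n → Bool
isPermᵇ {n} σ =
  Data.Bool.ListAction.and (concatMap (λ i → map (λ j →
     not ((toℕ i <ᵇ toℕ j) ∧ (toℕ (lookup σ i) ≡ᵇ toℕ (lookup σ j))))
     (allFin n)) (allFin n))

Perm : ℕ → Set
Perm n = Σ (Vec (Fin n) n) (λ σ → T (isPermᵇ σ))

inv : {n : ℕ} → Vec (Fin n) n → ℕ
inv {n} σ = sumFin n (λ i → sumFin n (λ j →
  [ (toℕ i <ᵇ toℕ j) ∧ (toℕ (lookup σ j) <ᵇ toℕ (lookup σ i)) ]ᵇ))

fix : {n : ℕ} → Vec (Fin n) n → ℕ
fix {n} σ = sumFin n (λ i → [ toℕ (lookup σ i) ≡ᵇ toℕ i ]ᵇ)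

exc : {n : ℕ} → Vec (Fin n) n → ℕ
exc {n} σ = sumFin n (λ i → [ toℕ i <ᵇ toℕ (lookup σ i) ]ᵇ)

depth : {n : ℕ} → Vec (Fin n) n → ℕ
depth {n} σ = sumFin n (λ i →
  if toℕ i <ᵇ toℕ (lookup σ i) then toℕ (lookup σ i) ∸ toℕ i else 0)

allWords : (m n : ℕ) → List (Vec (Fin n) m)
allWords zero    n = [] ∷ []
allWords (suc m) n = concatMap (λ i → map (i ∷_) (allWords m n)) (allFin n)

permsList : (n : ℕ) → List (Vec (Fin n) n)
permsList n = filter (λ σ → Data.Bool._≟_ (isPermᵇ σ) true) (allWords n n)

-- A step together with its weight choice a (0 ≤ a ≤ h-1 where relevant)
data Step : Set where
  U  : ℕ → Step
  D  : ℕ → Step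
  H₁ : ℕ → Step
  H₂ : ℕ → Step
  H₃ : Step

-- The height of a step is the
-- maximal y-coordinate it attains: U from y has height y+1, D from y has
-- height y, horizontal steps at y have height y.  Condition a ≤ h-1 is
-- written a < h.  H₁, H₂, D do not occur at height 0 (D from 0 would leave
-- the half-plane).
validFrom : ℕ → List Step → Bool
validFrom y       []          = y ≡ᵇ 0
validFrom y       (U a ∷ w)   = (a <ᵇ suc y) ∧ validFrom (suc y) w
validFrom zero    (D a ∷ w)   = false
validFrom (suc y) (D a ∷ w)   = (a <ᵇ suc y) ∧ validFrom y w
validFrom zero    (H₁ a ∷ w)  = false
validFrom (suc y) (H₁ a ∷ w)  = (a <ᵇ suc y) ∧ validFrom (suc y) w
validFrom zero    (H₂ a ∷ w)  = false
validFrom (suc y) (H₂ a ∷ w)  = (a <ᵇ suc y) ∧ validFrom (suc y) w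
validFrom y       (H₃ ∷ w)    = validFrom y w

W : ℕ → Set
W n = Σ (Vec Step n) (λ w → T (validFrom 0 (toList w)))

-- Monomials q^i p^j s^k t^ℓ represented by exponent vectors (i , j , k , ℓ)
Mono : Set
Mono = ℕ × ℕ × ℕ × ℕ

_⊕_ : Mono → Mono → Mono
(a , b , c , d) ⊕ (a' , b' , c' , d') = (a + a' , b + b' , c + c' , d + d')

one : Mono
one = (0 , 0 , 0 , 0)

ωU ωD ωH₁ ωH₂ : (h a : ℕ) → Mono
ωU  h a = (a , 0 , 1 , 2 * h ∸ 1)
ωD  h a = (2 * h ∸ 1 + a , 0 , 0 , 0)
ωH₁ h a = (h + a , 0 , 1 , h)
ωH₂ h a = (h + a , 0 , 0 , h)
ωH₃ : (h : ℕ) → Mono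
ωH₃ h = (2 * h , 1 , 0 , h)

weightFrom : ℕ → List Step → Mono
weightFrom y       []         = one
weightFrom y       (U a ∷ w)  = ωU (suc y) a ⊕ weightFrom (suc y) w
weightFrom zero    (D a ∷ w)  = ωD 0 a ⊕ weightFrom 0 w   -- never valid
weightFrom (suc y) (D a ∷ w)  = ωD (suc y) a ⊕ weightFrom y w
weightFrom y       (H₁ a ∷ w) = ωH₁ y a ⊕ weightFrom y w
weightFrom y       (H₂ a ∷ w) = ωH₂ y a ⊕ weightFrom y w
weightFrom y       (H₃ ∷ w)   = ωH₃ y ⊕ weightFrom y w

ω : {n : ℕ} → W n → Mono
ω (w , _) = weightFrom 0 (toList w)

-- Algebra in a commutative semiring: generating polynomials and
-- J-fractions (as formal power series, given by their coefficients)

module _ (R : CommutativeSemiring 0ℓ 0ℓ) where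
  open CommutativeSemiring R renaming (_+_ to _+ᴿ_; _*_ to _*ᴿ_)

  pow : Carrier → ℕ → Carrier
  pow x zero    = 1#
  pow x (suc k) = x *ᴿ pow x k

  ΣR : ℕ → (ℕ → Carrier) → Carrier
  ΣR zero    f = 0#
  ΣR (suc n) f = ΣR n f +ᴿ f n

  ΣL : {A : Set} → List A → (A → Carrier) → Carrier
  ΣL xs f = foldr (λ x acc → f x +ᴿ acc) 0# xs

  qint : Carrier → ℕ → Carrier
  qint q k = ΣR k (pow q)

  genPoly : (q p s t : Carrier) → ℕ → Carrier
  genPoly q p s t n = ΣL (permsList n) (λ σ →
    pow q (inv σ) *ᴿ pow p (fix σ) *ᴿ pow s (exc σ) *ᴿ pow t (depth σ))

  -- coefficient lookup, 0 outside range
  get : {k : ℕ} → Vec Carrier k → ℕ → Carrier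
  get []       _       = 0#
  get (x ∷ xs) zero    = x
  get (x ∷ xs) (suc i) = get xs i

  -- F_h = 1/(1 - γ_h z - λ_{h+1} z² F_{h+1}), i.e. the unique formal power
  -- series with F_h = 1 + γ_h z F_h + λ_{h+1} z² F_{h+1} F_h.
  -- jtab γ λ n h = coefficients [z^0 .. z^n] of F_h.
  jtab : (γ λ' : ℕ → Carrier) → (n : ℕ) → ℕ → Vec Carrier (suc n)
  jtab γ λ' zero    h = 1# ∷ []
  jtab γ λ' (suc n) h =
    jtab γ λ' n h ∷ʳ
      (γ h *ᴿ get (jtab γ λ' n h) n
       +ᴿ λ' (suc h) *ᴿ ΣR n (λ a →
            get (jtab γ λ' n (suc h)) a *ᴿ get (jtab γ λ' n h) (n ∸ 1 ∸ a)))

  JFrac : (γ λ' : ℕ → Carrier) → ℕ → Carrier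
  JFrac γ λ' n = get (jtab γ λ' n 0) n

  λseq : (q p s t : Carrier) → ℕ → Carrier
  λseq q p s t h = s *ᴿ (qint q h *ᴿ qint q h) *ᴿ pow (q *ᴿ t) (2 * h ∸ 1)

  γseq : (q p s t : Carrier) → ℕ → Carrier
  γseq q p s t h = ((1# +ᴿ s) *ᴿ qint q h +ᴿ p *ᴿ pow q h) *ᴿ pow (q *ᴿ t) h

module Submission where

-- A permutation is read from left to right.  Position i becomes the level step H₃ if σ(i) = i;
-- if σ(i) > i it becomes U or H₁, and if σ(i) < i it becomes H₂ or D, according as σ⁻¹(i) > i or
-- σ⁻¹(i) < i.  The height before position i is #{j < i | σ(j) ≥ i}.  After each step the unread
-- suffix is renumbered so that the value i becomes the height y and the values taken by pending
-- excedances become exactly the y missing letters, all ≥ y (`Admissible`); the parameter a of a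
-- step is then read off the renumbered letter, and steps are inverted one at a time.  Each
-- step changes inv, fix, exc and depth of the suffix by the exponents of its weight, up to the
-- correction `excess` caused by the renumbering, which for a whole permutation is
-- 0 + 1 + ⋯ + (n − 1) and cancels.  Summing over paths, the weight factors step by step, and
-- cutting a path at its first return to height h gives the J-fraction, with γ_h the total weight
-- of the level steps and λ_h the product of the total weights of the up and down steps at h.

open import Defs
open import Level using (0ℓ)
open import Data.Nat using (ℕ)
open import Data.Vec using (Vec)
open import Data.Product using (Σ; _×_; _,_; proj₁)
open import Relation.Binary.PropositionalEquality using (_≡_)
open import Algebra.Bundles using (CommutativeSemiring)

module Bijection where

  open import Data.Nat.Base
  open import Data.Nat.Properties
  open import Data.Nat.Solver using (module +-*-Solver)
  open +-*-Solver using (solve; _:+_; _:=_; con)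
  open import Algebra.Properties.CommutativeSemigroup +-commutativeSemigroup using (interchange; x∙yz≈y∙xz; x∙yz≈zx∙y)
  open import Data.Bool.Base using (Bool; true; false; _∧_; _∨_; not; if_then_else_; T)
  import Data.Bool.Properties as Bool
  open import Data.Bool.Properties using (T-≡; T-∧; T-not-≡; T-irrelevant; ∨-zeroʳ)
  open import Data.Bool.ListAction using (and)
  open import Data.Empty using (⊥; ⊥-elim)
  open import Data.Unit.Base using (⊤)
  open import Data.Product.Base using (Σ; _×_; _,_; proj₁; proj₂; ∃-syntax)
  open import Data.Product.Properties using (Σ-≡,≡→≡)
  open import Data.Sum.Base using (_⊎_; inj₁; inj₂)
  open import Data.Fin.Base using (Fin; toℕ; fromℕ<) renaming (zero to fzero; suc to fsuc)
  open import Data.Fin.Properties using (toℕ-fromℕ<; toℕ-injective; toℕ<n)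
  open import Data.Vec.Base using (Vec; []; _∷_; map; toList; lookup)
  open import Data.Vec.Properties using (map-id; map-∘; map-cong; ∷-injective)
  open import Data.Vec.Relation.Unary.All as All using (All; []; _∷_)
  open import Data.Vec.Relation.Unary.All.Properties using (map⁺; map⁻)
  open import Data.List.Base as List using (List; []; _∷_; foldr; tabulate; upTo; concatMap; _++_)
  open import Data.List.Properties using (map-tabulate; tabulate-cong)
  open import Data.List.Membership.Propositional using (_∈_)
  open import Data.List.Membership.Propositional.Properties
    using (∈-filter⁺; ∈-filter⁻; ∈-allFin; ∈-map⁺; ∈-map⁻; ∈-concat⁺′; ∈-concat⁻′; ∈-upTo⁺; ∈-upTo⁻)
  open import Data.List.Membership.Propositional.Properties.WithK using (unique∧set⇒bag)
  open import Data.List.Relation.Unary.Any using (here; there)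
  import Data.List.Relation.Unary.All as ListAll
  import Data.List.Relation.Unary.All.Properties as ListAll
  open import Data.List.Relation.Unary.AllPairs as AllPairs using ([]; _∷_)
  import Data.List.Relation.Unary.AllPairs.Properties as AllPairs
  open import Data.List.Relation.Unary.Unique.Propositional using (Unique)
  import Data.List.Relation.Unary.Unique.Propositional.Properties as Unique
  open import Data.List.Relation.Binary.Permutation.Propositional using (_↭_)
  open import Data.List.Relation.Binary.BagAndSetEquality using (∼bag⇒↭)
  open import Function.Base using (_∘_; _∘′_; id)
  open import Function.Bundles using (Equivalence; mk⇔)
  open import Function.Definitions using (Injective)
  open import Relation.Binary.Definitions using (tri<; tri≈; tri>)
  open import Relation.Binary.PropositionalEquality
  open import Relation.Nullary.Negation using (¬_; contradiction)
  open import Relation.Nullary.Decidable.Core using (yes; no)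

  T⇒≡true : ∀ {b} → T b → b ≡ true
  T⇒≡true = Equivalence.to T-≡

  ¬T⇒≡false : ∀ {b} → ¬ T b → b ≡ false
  ¬T⇒≡false {false} _ = refl
  ¬T⇒≡false {true} ¬t = contradiction _ ¬t

  ≡ᵇ-refl : ∀ n → (n ≡ᵇ n) ≡ true
  ≡ᵇ-refl n = T⇒≡true (≡⇒≡ᵇ n n refl)

  ≢⇒≡ᵇ-false : ∀ {m n} → m ≢ n → (m ≡ᵇ n) ≡ false
  ≢⇒≡ᵇ-false m≢n = ¬T⇒≡false (m≢n ∘′ ≡ᵇ⇒≡ _ _)

  ≡ᵇ-false⇒≢ : ∀ {m n} → (m ≡ᵇ n) ≡ false → m ≢ n
  ≡ᵇ-false⇒≢ {m} m≢ᵇm refl = contradiction (trans (sym (≡ᵇ-refl m)) m≢ᵇm) λ ()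

  <⇒<ᵇ-true : ∀ {m n} → m < n → (m <ᵇ n) ≡ true
  <⇒<ᵇ-true m<n = T⇒≡true (<⇒<ᵇ m<n)

  ≤⇒<ᵇ-false : ∀ {m n} → n ≤ m → (m <ᵇ n) ≡ false
  ≤⇒<ᵇ-false n≤m = ¬T⇒≡false (λ t → <⇒≱ (<ᵇ⇒< _ _ t) n≤m)

  <ᵇ-true⇒< : ∀ {m n} → (m <ᵇ n) ≡ true → m < n
  <ᵇ-true⇒< m<ᵇn = <ᵇ⇒< _ _ (subst T (sym m<ᵇn) _)

  <ᵇ-false⇒≥ : ∀ {m n} → (m <ᵇ n) ≡ false → n ≤ m
  <ᵇ-false⇒≥ m≮ᵇn = ≮⇒≥ (λ m<n → contradiction (trans (sym (<⇒<ᵇ-true m<n)) m≮ᵇn) λ ())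

  +-≡ᵇ : ∀ d a b → (d + a ≡ᵇ d + b) ≡ (a ≡ᵇ b)
  +-≡ᵇ zero a b = refl
  +-≡ᵇ (suc d) a b = +-≡ᵇ d a b

  +-<ᵇ : ∀ d a b → (d + a <ᵇ d + b) ≡ (a <ᵇ b)
  +-<ᵇ zero a b = refl
  +-<ᵇ (suc d) a b = +-<ᵇ d a b

  [b]+[not-b]≡1 : ∀ b → [ b ]ᵇ + [ not b ]ᵇ ≡ 1
  [b]+[not-b]≡1 true = refl
  [b]+[not-b]≡1 false = refl

  sumℕ-zero : ∀ n {f : ℕ → ℕ} → (∀ {l} → l < n → f l ≡ 0) → sumℕ n f ≡ 0
  sumℕ-zero zero _ = refl
  sumℕ-zero (suc n) f≡0 = cong₂ _+_ (sumℕ-zero n (f≡0 ∘ m<n⇒m<1+n)) (f≡0 ≤-refl)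

  sumℕ-zero⁻ : ∀ n {f : ℕ → ℕ} → sumℕ n f ≡ 0 → ∀ {l} → l < n → f l ≡ 0
  sumℕ-zero⁻ (suc n) sum≡0 {l} l<1+n with m≤n⇒m<n∨m≡n (≤-pred l<1+n)
  ... | inj₁ l<n = sumℕ-zero⁻ n (m+n≡0⇒m≡0 _ sum≡0) l<n
  ... | inj₂ refl = m+n≡0⇒n≡0 _ sum≡0

  sumℕ-cong : ∀ n {f g : ℕ → ℕ} → (∀ {l} → l < n → f l ≡ g l) → sumℕ n f ≡ sumℕ n g
  sumℕ-cong zero _ = refl
  sumℕ-cong (suc n) f≡g = cong₂ _+_ (sumℕ-cong n (f≡g ∘ m<n⇒m<1+n)) (f≡g ≤-refl)

  sumℕ-+ : ∀ n (f g : ℕ → ℕ) → sumℕ n (λ l → f l + g l) ≡ sumℕ n f + sumℕ n g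
  sumℕ-+ zero f g = refl
  sumℕ-+ (suc n) f g = trans (cong (_+ (f n + g n)) (sumℕ-+ n f g)) (interchange (sumℕ n f) (sumℕ n g) (f n) (g n))

  sumℕ-monoˡ-≤ : ∀ f {a b} → a ≤ b → sumℕ a f ≤ sumℕ b f
  sumℕ-monoˡ-≤ f {b = zero} z≤n = ≤-refl
  sumℕ-monoˡ-≤ f {a} {suc b} a≤1+b with m≤n⇒m<n∨m≡n a≤1+b
  ... | inj₁ a<1+b = ≤-trans (sumℕ-monoˡ-≤ f (≤-pred a<1+b)) (m≤m+n _ _)
  ... | inj₂ refl = ≤-refl

  sumℕ-point : ∀ n {x} → x < n → sumℕ n (λ l → [ l ≡ᵇ x ]ᵇ * l) ≡ x
  sumℕ-point (suc n) {x} x<1+n with m≤n⇒m<n∨m≡n (≤-pred x<1+n)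
  ... | inj₁ x<n rewrite ≢⇒≡ᵇ-false (>⇒≢ x<n) = trans (+-identityʳ _) (sumℕ-point n x<n)
  ... | inj₂ refl rewrite ≡ᵇ-refl x =
    cong₂ _+_ (sumℕ-zero x (λ {l} l<x → cong (λ b → [ b ]ᵇ * l) (≢⇒≡ᵇ-false (<⇒≢ l<x)))) (+-identityʳ x)

  punchIn : ℕ → ℕ → ℕ
  punchIn zero l = suc l
  punchIn (suc c) zero = zero
  punchIn (suc c) (suc l) = suc (punchIn c l)

  punchOut : ℕ → ℕ → ℕ
  punchOut zero l = pred l
  punchOut (suc c) zero = zero
  punchOut (suc c) (suc l) = suc (punchOut c l)

  punchIn-< : ∀ {c l} → l < c → punchIn c l ≡ l
  punchIn-< {suc c} {zero} _ = refl
  punchIn-< {suc c} {suc l} (s≤s l<c) = cong suc (punchIn-< l<c)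

  punchIn-≥ : ∀ {c l} → c ≤ l → punchIn c l ≡ suc l
  punchIn-≥ {zero} _ = refl
  punchIn-≥ {suc c} {suc l} (s≤s c≤l) = cong suc (punchIn-≥ c≤l)

  punchIn-≤ : ∀ c l → punchIn c l ≤ suc l
  punchIn-≤ zero l = ≤-refl
  punchIn-≤ (suc c) zero = z≤n
  punchIn-≤ (suc c) (suc l) = s≤s (punchIn-≤ c l)

  punchIn-bounded : ∀ c {l N} → l < N → punchIn c l < suc N
  punchIn-bounded c {l} l<N = ≤-<-trans (punchIn-≤ c l) (s≤s l<N)

  punchIn-bounded⁻ : ∀ {c N l} → c ≤ N → punchIn c l < suc N → l < N
  punchIn-bounded⁻ {c} {N} {l} c≤N p<1+N with l <? c
  ... | yes l<c = <-≤-trans l<c c≤N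
  ... | no l≮c rewrite punchIn-≥ (≮⇒≥ l≮c) = ≤-pred p<1+N

  punchInᵢ≢i : ∀ c l → punchIn c l ≢ c
  punchInᵢ≢i (suc c) (suc l) eq = punchInᵢ≢i c l (suc-injective eq)

  punchOut-< : ∀ {c l} → l < c → punchOut c l ≡ l
  punchOut-< {suc c} {zero} _ = refl
  punchOut-< {suc c} {suc l} (s≤s l<c) = cong suc (punchOut-< l<c)

  punchOut-> : ∀ {c l} → c < l → punchOut c l ≡ pred l
  punchOut-> {zero} _ = refl
  punchOut-> {suc c} {suc (suc l)} (s≤s c<1+l) = cong suc (punchOut-> c<1+l)

  punchOut≢ : ∀ {x c l} → x < c → l ≢ x → l ≢ c → punchOut c l ≢ x
  punchOut≢ {x} {c} {l} x<c l≢x l≢c with <-cmp l c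
  ... | tri< l<c _ _ rewrite punchOut-< l<c = l≢x
  ... | tri≈ _ l≡c _ = contradiction l≡c l≢c
  ... | tri> _ _ c<l rewrite punchOut-> c<l = >⇒≢ (<-≤-trans x<c (pred-mono-≤ c<l))

  punchOut-punchIn : ∀ c l → punchOut c (punchIn c l) ≡ l
  punchOut-punchIn zero l = refl
  punchOut-punchIn (suc c) zero = refl
  punchOut-punchIn (suc c) (suc l) = cong suc (punchOut-punchIn c l)

  punchIn-punchOut : ∀ {c l} → l ≢ c → punchIn c (punchOut c l) ≡ l
  punchIn-punchOut {zero} {zero} l≢c = contradiction refl l≢c
  punchIn-punchOut {zero} {suc l} _ = refl
  punchIn-punchOut {suc c} {zero} _ = refl
  punchIn-punchOut {suc c} {suc l} l≢c = cong suc (punchIn-punchOut (l≢c ∘ cong suc))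

  punchIn-injective : ∀ c {a b} → punchIn c a ≡ punchIn c b → a ≡ b
  punchIn-injective c {a} {b} eq =
    trans (sym (punchOut-punchIn c a)) (trans (cong (punchOut c) eq) (punchOut-punchIn c b))

  punchIn-<ᵇ : ∀ c a b → (punchIn c a <ᵇ punchIn c b) ≡ (a <ᵇ b)
  punchIn-<ᵇ zero a b = refl
  punchIn-<ᵇ (suc c) zero zero = refl
  punchIn-<ᵇ (suc c) zero (suc b) = refl
  punchIn-<ᵇ (suc c) (suc a) zero = refl
  punchIn-<ᵇ (suc c) (suc a) (suc b) = punchIn-<ᵇ c a b

  punchIn-<ᵇ-below : ∀ c {a} l → a ≤ c → (punchIn c l <ᵇ a) ≡ (l <ᵇ a)
  punchIn-<ᵇ-below c {a} l a≤c with l <? c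
  ... | yes l<c rewrite punchIn-< l<c = refl
  ... | no l≮c rewrite punchIn-≥ (≮⇒≥ l≮c) =
    trans (≤⇒<ᵇ-false (m≤n⇒m≤1+n c≤l)) (sym (≤⇒<ᵇ-false c≤l))
    where c≤l = ≤-trans a≤c (≮⇒≥ l≮c)

  punchOut-bounded : ∀ {c N l} → c ≤ N → l < suc N → l ≢ c → punchOut c l < N
  punchOut-bounded {c} {N} {l} c≤N l<1+N l≢c with <-cmp l c
  ... | tri< l<c _ _ rewrite punchOut-< l<c = <-≤-trans l<c c≤N
  ... | tri≈ _ l≡c _ = contradiction l≡c l≢c
  ... | tri> _ _ c<l rewrite punchOut-> c<l = pred-mono-< ⦃ >-nonZero (<-≤-trans z<s c<l) ⦄ l<1+N

  -- Words of distinct natural numbers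

  _∈ᵇ_ : ∀ {m} → ℕ → Vec ℕ m → Bool
  x ∈ᵇ [] = false
  x ∈ᵇ (l ∷ w) = (x ≡ᵇ l) ∨ (x ∈ᵇ w)

  countLess : ∀ {m} → ℕ → Vec ℕ m → ℕ
  countLess x [] = 0
  countLess x (l ∷ w) = [ l <ᵇ x ]ᵇ + countLess x w

  missingBelow : ∀ {m} → Vec ℕ m → ℕ → ℕ
  missingBelow g x = sumℕ x (λ l → [ not (l ∈ᵇ g) ]ᵇ)

  Distinct : ∀ {m} → Vec ℕ m → Set
  Distinct [] = ⊤
  Distinct (x ∷ w) = (x ∈ᵇ w ≡ false) × Distinct w

  ≡ᵇ-injective : ∀ {f : ℕ → ℕ} → Injective _≡_ _≡_ f → ∀ a b → (f a ≡ᵇ f b) ≡ (a ≡ᵇ b)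
  ≡ᵇ-injective {f} f-inj a b with a ≟ b
  ... | yes refl = trans (≡ᵇ-refl (f a)) (sym (≡ᵇ-refl a))
  ... | no a≢b = trans (≢⇒≡ᵇ-false (a≢b ∘ f-inj)) (sym (≢⇒≡ᵇ-false a≢b))

  ∈ᵇ-map : ∀ {m} {f : ℕ → ℕ} → Injective _≡_ _≡_ f → ∀ x (w : Vec ℕ m) → (f x ∈ᵇ map f w) ≡ (x ∈ᵇ w)
  ∈ᵇ-map f-inj x [] = refl
  ∈ᵇ-map f-inj x (l ∷ w) = cong₂ _∨_ (≡ᵇ-injective f-inj x l) (∈ᵇ-map f-inj x w)

  ∉-map : ∀ {m c} {f : ℕ → ℕ} → (∀ l → f l ≢ c) → (w : Vec ℕ m) → c ∈ᵇ map f w ≡ false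
  ∉-map f≢c [] = refl
  ∉-map f≢c (l ∷ w) rewrite ≢⇒≡ᵇ-false (≢-sym (f≢c l)) = ∉-map f≢c w

  ∈ᵇ-∷⁻ : ∀ {m l x} (w : Vec ℕ m) → l ∈ᵇ (x ∷ w) ≡ true → l ≢ x → l ∈ᵇ w ≡ true
  ∈ᵇ-∷⁻ w l∈x∷w l≢x rewrite ≢⇒≡ᵇ-false l≢x = l∈x∷w

  ∉⇒All≢ : ∀ {m c} (w : Vec ℕ m) → c ∈ᵇ w ≡ false → All (_≢ c) w
  ∉⇒All≢ [] _ = []
  ∉⇒All≢ {c = c} (l ∷ w) c∉l∷w with c ≡ᵇ l in c≡ᵇl
  ... | true = contradiction c∉l∷w λ ()
  ... | false = ≢-sym (≡ᵇ-false⇒≢ c≡ᵇl) ∷ ∉⇒All≢ w c∉l∷w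

  Distinct-map : ∀ {m} {f : ℕ → ℕ} → Injective _≡_ _≡_ f → (w : Vec ℕ m) → Distinct w → Distinct (map f w)
  Distinct-map f-inj [] _ = _
  Distinct-map f-inj (l ∷ w) (l∉w , distinct) = trans (∈ᵇ-map f-inj l w) l∉w , Distinct-map f-inj w distinct

  Distinct-map⁻ : ∀ {m} {f : ℕ → ℕ} → Injective _≡_ _≡_ f → (w : Vec ℕ m) → Distinct (map f w) → Distinct w
  Distinct-map⁻ f-inj [] _ = _
  Distinct-map⁻ f-inj (l ∷ w) (fl∉fw , distinct) = trans (sym (∈ᵇ-map f-inj l w)) fl∉fw , Distinct-map⁻ f-inj w distinct

  map-fixes : ∀ {m} {f : ℕ → ℕ} {w : Vec ℕ m} → All (λ l → f l ≡ l) w → map f w ≡ w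
  map-fixes [] = refl
  map-fixes (fl≡l ∷ fixes) = cong₂ _∷_ fl≡l (map-fixes fixes)

  punchIn-punchOut-avoiding : ∀ {m c} (w : Vec ℕ m) → c ∈ᵇ w ≡ false → map (punchIn c) (map (punchOut c) w) ≡ w
  punchIn-punchOut-avoiding w c∉w =
    trans (sym (map-∘ _ _ w)) (map-fixes (All.map punchIn-punchOut (∉⇒All≢ w c∉w)))

  countLess-suc : ∀ {m} x (g : Vec ℕ m) → Distinct g →
                  countLess (suc x) g ≡ countLess x g + [ x ∈ᵇ g ]ᵇ
  countLess-suc x [] _ = refl
  countLess-suc x (l ∷ w) (l∉w , distinct) with <-cmp l x
  ... | tri< l<x l≢x _
    rewrite <⇒<ᵇ-true l<x | <⇒<ᵇ-true (m<n⇒m<1+n l<x) | ≢⇒≡ᵇ-false (≢-sym l≢x)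
    = cong suc (countLess-suc x w distinct)
  ... | tri≈ _ refl _
    rewrite ≤⇒<ᵇ-false (≤-refl {l}) | <⇒<ᵇ-true (n<1+n l) | ≡ᵇ-refl l
          | countLess-suc l w distinct | l∉w
    = trans (cong suc (+-identityʳ _)) (+-comm 1 _)
  ... | tri> _ l≢x x<l
    rewrite ≤⇒<ᵇ-false (<⇒≤ x<l) | ≤⇒<ᵇ-false x<l | ≢⇒≡ᵇ-false (≢-sym l≢x)
    = countLess-suc x w distinct

  countLess+missingBelow : ∀ {m} x (g : Vec ℕ m) → Distinct g → countLess x g + missingBelow g x ≡ x
  countLess+missingBelow zero g _ = countLess-zero g
    where
      countLess-zero : ∀ {m} (g : Vec ℕ m) → countLess 0 g + 0 ≡ 0
      countLess-zero [] = refl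
      countLess-zero (_ ∷ w) = countLess-zero w
  countLess+missingBelow (suc x) g distinct = begin
    countLess (suc x) g + (missingBelow g x + [ not (x ∈ᵇ g) ]ᵇ)
      ≡⟨ cong (_+ (missingBelow g x + [ not (x ∈ᵇ g) ]ᵇ)) (countLess-suc x g distinct) ⟩
    (countLess x g + [ x ∈ᵇ g ]ᵇ) + (missingBelow g x + [ not (x ∈ᵇ g) ]ᵇ)
      ≡⟨ interchange (countLess x g) _ _ _ ⟩
    (countLess x g + missingBelow g x) + ([ x ∈ᵇ g ]ᵇ + [ not (x ∈ᵇ g) ]ᵇ)
      ≡⟨ cong₂ _+_ (countLess+missingBelow x g distinct) ([b]+[not-b]≡1 (x ∈ᵇ g)) ⟩
    x + 1
      ≡⟨ +-comm x 1 ⟩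
    suc x ∎
    where open ≡-Reasoning

  countLess-all : ∀ {m N} (g : Vec ℕ m) → All (_< N) g → countLess N g ≡ m
  countLess-all [] [] = refl
  countLess-all (l ∷ w) (l<N ∷ bounded) rewrite <⇒<ᵇ-true l<N = cong suc (countLess-all w bounded)

  countLess-map : ∀ {m x x′} {f : ℕ → ℕ} → (∀ l → (f l <ᵇ x) ≡ (l <ᵇ x′)) → (g : Vec ℕ m) →
                  countLess x (map f g) ≡ countLess x′ g
  countLess-map f<x [] = refl
  countLess-map f<x (l ∷ w) = cong₂ _+_ (cong [_]ᵇ (f<x l)) (countLess-map f<x w)

  missingBelow-suc-∉ : ∀ {m x} (g : Vec ℕ m) → x ∈ᵇ g ≡ false → missingBelow g (suc x) ≡ suc (missingBelow g x)
  missingBelow-suc-∉ {x = x} g x∉g = trans (cong (λ b → missingBelow g x + [ not b ]ᵇ) x∉g) (+-comm _ 1)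

  missingBelow-< : ∀ {m x N} (g : Vec ℕ m) → x ∈ᵇ g ≡ false → x < N → missingBelow g x < missingBelow g N
  missingBelow-< {N = N} g x∉g x<N =
    subst (_≤ missingBelow g N) (missingBelow-suc-∉ g x∉g) (sumℕ-monoˡ-≤ _ x<N)

  nthMissing : ∀ {m} → Vec ℕ m → ℕ → ℕ → ℕ
  nthMissing g zero b = zero
  nthMissing g (suc N) b = if b <ᵇ missingBelow g N then nthMissing g N b else N

  record IsNthMissing {m} (g : Vec ℕ m) (N b x : ℕ) : Set where
    field
      missing : x ∈ᵇ g ≡ false
      rank    : missingBelow g x ≡ b
      bound   : x < N

  nthMissing-spec : ∀ {m} (g : Vec ℕ m) N {b} → b < missingBelow g N → IsNthMissing g N b (nthMissing g N b)
  nthMissing-spec g (suc N) {b} b<mb with b <ᵇ missingBelow g N in b<ᵇmb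
  ... | true = record { missing = missing ; rank = rank ; bound = m<n⇒m<1+n bound }
    where open IsNthMissing (nthMissing-spec g N (<ᵇ-true⇒< b<ᵇmb))
  ... | false with N ∈ᵇ g in N∈g
  ...   | true = contradiction (subst (b <_) (+-identityʳ _) b<mb) (≤⇒≯ (<ᵇ-false⇒≥ b<ᵇmb))
  ...   | false = record
    { missing = N∈g
    ; rank    = ≤-antisym (<ᵇ-false⇒≥ b<ᵇmb) (≤-pred (subst (b <_) (+-comm _ 1) b<mb))
    ; bound   = ≤-refl
    }

  nthMissing-missingBelow : ∀ {m x} (g : Vec ℕ m) N → x ∈ᵇ g ≡ false → x < N → nthMissing g N (missingBelow g x) ≡ x
  nthMissing-missingBelow {x = x} g (suc N) x∉g x<1+N with m≤n⇒m<n∨m≡n (≤-pred x<1+N)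
  ... | inj₁ x<N rewrite <⇒<ᵇ-true (missingBelow-< g x∉g x<N) = nthMissing-missingBelow g N x∉g x<N
  ... | inj₂ refl rewrite ≤⇒<ᵇ-false (≤-refl {missingBelow g x}) = refl

  record Admissible {m} (y : ℕ) (g : Vec ℕ m) : Set where
    field
      distinct : Distinct g
      bounded  : All (_< y + m) g
      complete : ∀ {l} → l < y → l ∈ᵇ g ≡ true

  module _ {m y} {g : Vec ℕ m} (adm : Admissible y g) where
    open Admissible adm

    missingBelow-total : missingBelow g (y + m) ≡ y
    missingBelow-total = +-cancelˡ-≡ m _ _ (begin
      m + missingBelow g (y + m)                ≡⟨ cong (_+ missingBelow g (y + m)) (countLess-all g bounded) ⟨
      countLess (y + m) g + missingBelow g (y + m) ≡⟨ countLess+missingBelow (y + m) g distinct ⟩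
      y + m                                     ≡⟨ +-comm y m ⟩
      m + y                                     ∎)
      where open ≡-Reasoning

    countLess-complete : ∀ {a} → a ≤ y → countLess a g ≡ a
    countLess-complete {a} a≤y = begin
      countLess a g                    ≡⟨ +-identityʳ _ ⟨
      countLess a g + 0                ≡⟨ cong (countLess a g +_) nothing-missing ⟨
      countLess a g + missingBelow g a ≡⟨ countLess+missingBelow a g distinct ⟩
      a                                ∎
      where
        open ≡-Reasoning
        nothing-missing : missingBelow g a ≡ 0
        nothing-missing = sumℕ-zero a (λ l<a → cong (λ b → [ not b ]ᵇ) (complete (<-≤-trans l<a a≤y)))

    missing⇒≥ : ∀ {x} → x ∈ᵇ g ≡ false → y ≤ x
    missing⇒≥ {x} x∉g with x <? y
    ... | yes x<y = contradiction (trans (sym (complete x<y)) x∉g) λ ()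
    ... | no x≮y = ≮⇒≥ x≮y

  nthMissing-admissible : ∀ {m y b} {g : Vec ℕ m} → Admissible y g → b < y →
                          IsNthMissing g (y + m) b (nthMissing g (y + m) b)
  nthMissing-admissible {g = g} adm b<y =
    nthMissing-spec g _ (subst (_ <_) (sym (missingBelow-total adm)) b<y)

  admissible-∷ : ∀ {m y y′ x} {f : ℕ → ℕ} {g : Vec ℕ m} → Injective _≡_ _≡_ f → Admissible y′ g →
    x ∈ᵇ map f g ≡ false → x < suc (y + m) → (∀ {l} → l < y′ + m → f l < suc (y + m)) →
    (∀ {l} → l < y → l ≡ x ⊎ ∃[ l′ ] (l′ < y′ × f l′ ≡ l)) →
    Admissible y (x ∷ map f g)
  admissible-∷ {m} {y} {x = x} {f} {g} f-inj adm x∉fg x<bound f-bounded below-y = record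
    { distinct = x∉fg , Distinct-map f-inj g distinct
    ; bounded  = subst (λ N → All (_< N) (x ∷ map f g)) (sym (+-suc y m)) (x<bound ∷ map⁺ (All.map f-bounded bounded))
    ; complete = complete′ ∘ below-y
    }
    where
      open Admissible adm
      complete′ : ∀ {l} → l ≡ x ⊎ ∃[ l′ ] (l′ < _ × f l′ ≡ l) → l ∈ᵇ (x ∷ map f g) ≡ true
      complete′ (inj₁ refl) rewrite ≡ᵇ-refl x = refl
      complete′ (inj₂ (l′ , l′<y′ , refl)) rewrite ∈ᵇ-map f-inj l′ g | complete l′<y′ = ∨-zeroʳ _

  admissible-∷⁻ : ∀ {m y y′ x} {f : ℕ → ℕ} {g : Vec ℕ m} → Injective _≡_ _≡_ f → Admissible y (x ∷ map f g) →
    (∀ {l} → f l < suc (y + m) → l < y′ + m) →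
    (∀ {l} → l < y′ → (f l ≢ x × f l < y) ⊎ f l ∈ᵇ map f g ≡ true) →
    Admissible y′ g
  admissible-∷⁻ {m} {y} {x = x} {f} {g} f-inj adm f-bounded⁻ below-y′ = record
    { distinct = Distinct-map⁻ f-inj g (proj₂ distinct)
    ; bounded  = All.map (λ {l} fl<bound → f-bounded⁻ (subst (f l <_) (+-suc y m) fl<bound)) (map⁻ (All.tail bounded))
    ; complete = λ l<y′ → trans (sym (∈ᵇ-map f-inj _ g)) (complete′ (below-y′ l<y′))
    }
    where
      open Admissible adm
      complete′ : ∀ {l} → (f l ≢ x × f l < y) ⊎ f l ∈ᵇ map f g ≡ true → f l ∈ᵇ map f g ≡ true
      complete′ (inj₁ (fl≢x , fl<y)) = ∈ᵇ-∷⁻ (map f g) (complete fl<y) fl≢x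
      complete′ (inj₂ fl∈fg) = fl∈fg

  countLess-rank : ∀ {m y x a} {g : Vec ℕ m} → Distinct g → missingBelow g x ≡ y ∸ a → a ≤ y → y ≤ x →
                   countLess x g ≡ a + (x ∸ y)
  countLess-rank {m} {y} {x} {a} {g} distinct rank a≤y y≤x = +-cancelʳ-≡ (y ∸ a) _ _ (begin
    countLess x g + (y ∸ a)          ≡⟨ cong (countLess x g +_) rank ⟨
    countLess x g + missingBelow g x ≡⟨ countLess+missingBelow x g distinct ⟩
    x                                ≡⟨ m∸n+n≡m y≤x ⟨
    (x ∸ y) + y                      ≡⟨ cong ((x ∸ y) +_) (m∸n+n≡m a≤y) ⟨
    (x ∸ y) + ((y ∸ a) + a)          ≡⟨ x∙yz≈zx∙y (x ∸ y) (y ∸ a) a ⟩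
    (a + (x ∸ y)) + (y ∸ a)          ∎)
    where open ≡-Reasoning

  -- Encoding paths as words

  next : ℕ → Step → ℕ
  next y (U _) = suc y
  next y (D _) = pred y
  next y (H₁ _) = y
  next y (H₂ _) = y
  next y H₃ = y

  allowed : ℕ → Step → Bool
  allowed y (U a) = a <ᵇ suc y
  allowed y (D a) = a <ᵇ y
  allowed y (H₁ a) = a <ᵇ y
  allowed y (H₂ a) = a <ᵇ y
  allowed y H₃ = true

  stepWeight : ℕ → Step → Mono
  stepWeight y (U a) = ωU (suc y) a
  stepWeight y (D a) = ωD y a
  stepWeight y (H₁ a) = ωH₁ y a
  stepWeight y (H₂ a) = ωH₂ y a
  stepWeight y H₃ = ωH₃ y

  validFrom-∷ : ∀ y st (w : List Step) → validFrom y (st ∷ w) ≡ allowed y st ∧ validFrom (next y st) w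
  validFrom-∷ y (U a) w = refl
  validFrom-∷ zero (D a) w = refl
  validFrom-∷ (suc y) (D a) w = refl
  validFrom-∷ zero (H₁ a) w = refl
  validFrom-∷ (suc y) (H₁ a) w = refl
  validFrom-∷ zero (H₂ a) w = refl
  validFrom-∷ (suc y) (H₂ a) w = refl
  validFrom-∷ y H₃ w = refl

  weightFrom-∷ : ∀ y st (w : List Step) → weightFrom y (st ∷ w) ≡ stepWeight y st ⊕ weightFrom (next y st) w
  weightFrom-∷ y (U a) w = refl
  weightFrom-∷ zero (D a) w = refl
  weightFrom-∷ (suc y) (D a) w = refl
  weightFrom-∷ y (H₁ a) w = refl
  weightFrom-∷ y (H₂ a) w = refl
  weightFrom-∷ y H₃ w = refl

  relabel : ℕ → Step → ℕ → ℕ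
  relabel y (U a) = id
  relabel y (D a) = punchIn y ∘ punchIn a
  relabel y (H₁ a) = punchIn y
  relabel y (H₂ a) = punchIn a
  relabel y H₃ = punchIn y

  unrelabel : ℕ → Step → ℕ → ℕ
  unrelabel y (U a) = id
  unrelabel y (D a) = punchOut a ∘ punchOut y
  unrelabel y (H₁ a) = punchOut y
  unrelabel y (H₂ a) = punchOut a
  unrelabel y H₃ = punchOut y

  unrelabel-relabel : ∀ y st l → unrelabel y st (relabel y st l) ≡ l
  unrelabel-relabel y (U a) l = refl
  unrelabel-relabel y (D a) l = trans (cong (punchOut a) (punchOut-punchIn y (punchIn a l))) (punchOut-punchIn a l)
  unrelabel-relabel y (H₁ a) l = punchOut-punchIn y l
  unrelabel-relabel y (H₂ a) l = punchOut-punchIn a l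
  unrelabel-relabel y H₃ l = punchOut-punchIn y l

  relabel-injective : ∀ y st → Injective _≡_ _≡_ (relabel y st)
  relabel-injective y st {a} {b} eq =
    trans (sym (unrelabel-relabel y st a)) (trans (cong (unrelabel y st) eq) (unrelabel-relabel y st b))

  map-unrelabel-relabel : ∀ {m} y st (g : Vec ℕ m) → map (unrelabel y st) (map (relabel y st) g) ≡ g
  map-unrelabel-relabel y st g = trans (sym (map-∘ _ _ g)) (trans (map-cong (unrelabel-relabel y st) g) (map-id g))

  firstLetter : ∀ {m} → ℕ → Step → Vec ℕ m → ℕ
  firstLetter {m} y (U a) g = nthMissing g (suc y + m) (y ∸ a)
  firstLetter y (D a) g = a
  firstLetter {m} y (H₁ a) g = punchIn y (nthMissing g (y + m) (pred y ∸ a))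
  firstLetter y (H₂ a) g = a
  firstLetter y H₃ g = y

  encode : ∀ {m} → ℕ → Vec Step m → Vec ℕ m
  encode y [] = []
  encode y (st ∷ v) = firstLetter y st g ∷ map (relabel y st) g
    where g = encode (next y st) v

  classify : ∀ {m} → ℕ → ℕ → Vec ℕ m → Step
  classify y x w =
    if x ≡ᵇ y then H₃
    else if y <ᵇ x then
      (if y ∈ᵇ w then U (y ∸ missingBelow w x)
       else H₁ (pred y ∸ missingBelow (map (punchOut y) w) (punchOut y x)))
    else (if y ∈ᵇ w then H₂ x else D x)

  decode : ∀ {m} → ℕ → Vec ℕ m → Vec Step m
  decode y [] = []
  decode y (x ∷ w) = st ∷ decode (next y st) (map (unrelabel y st) w)
    where st = classify y x w

  -- Statistics along the encoding

  invWord : ∀ {m} → Vec ℕ m → ℕ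
  invWord [] = 0
  invWord (x ∷ w) = countLess x w + invWord w

  sumFrom : ∀ {m} → (ℕ → ℕ → ℕ) → ℕ → Vec ℕ m → ℕ
  sumFrom h y [] = 0
  sumFrom h y (x ∷ w) = h y x + sumFrom h (suc y) w

  fixFrom excFrom depthFrom : ∀ {m} → ℕ → Vec ℕ m → ℕ
  fixFrom = sumFrom (λ i x → [ x ≡ᵇ i ]ᵇ)
  excFrom = sumFrom (λ i x → [ i <ᵇ x ]ᵇ)
  depthFrom = sumFrom (λ i x → x ∸ i)

  excess : ∀ {m} → ℕ → Vec ℕ m → ℕ
  excess y [] = 0
  excess y (x ∷ w) = (x ∸ y) + excess y w

  triangle : ℕ → ℕ
  triangle zero = 0
  triangle (suc k) = triangle k + k

  invWord-map : ∀ {m} {f : ℕ → ℕ} → (∀ a b → (f a <ᵇ f b) ≡ (a <ᵇ b)) → (g : Vec ℕ m) →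
                invWord (map f g) ≡ invWord g
  invWord-map f-mono [] = refl
  invWord-map f-mono (x ∷ w) = cong₂ _+_ (countLess-map (λ l → f-mono l x) w) (invWord-map f-mono w)

  record Shift (y y′ : ℕ) (f : ℕ → ℕ) : Set where
    field
      gap       : ℕ
      gap-eq    : suc y ≡ gap + y′
      above     : ∀ {l} → y′ ≤ l → f l ≡ gap + l
      below     : ∀ {l} → l < y′ → f l ≤ y
      monotone  : ∀ a b → (f a <ᵇ f b) ≡ (a <ᵇ b)

  module ShiftProperties {y y′ f} (shift : Shift y y′ f) where
    open Shift shift

    private
      offset-eq : ∀ j → j + suc y ≡ gap + (j + y′)
      offset-eq j = trans (cong (j +_) gap-eq) (x∙yz≈y∙xz j gap y′)

      below-offset : ∀ j {l} → l < y′ → f l < j + suc y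
      below-offset j l<y′ = ≤-<-trans (below l<y′) (subst (y <_) (sym (+-suc j y)) (s≤s (m≤n+m y j)))

    fix-letter : ∀ j l → (f l ≡ᵇ j + suc y) ≡ (l ≡ᵇ j + y′)
    fix-letter j l with l <? y′
    ... | yes l<y′ = trans (≢⇒≡ᵇ-false (<⇒≢ (below-offset j l<y′)))
                           (sym (≢⇒≡ᵇ-false (<⇒≢ (<-≤-trans l<y′ (m≤n+m y′ j)))))
    ... | no l≮y′ rewrite above (≮⇒≥ l≮y′) | offset-eq j = +-≡ᵇ gap l (j + y′)

    exc-letter : ∀ j l → (j + suc y <ᵇ f l) ≡ (j + y′ <ᵇ l)
    exc-letter j l with l <? y′
    ... | yes l<y′ = trans (≤⇒<ᵇ-false (<⇒≤ (below-offset j l<y′)))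
                           (sym (≤⇒<ᵇ-false (<⇒≤ (<-≤-trans l<y′ (m≤n+m y′ j)))))
    ... | no l≮y′ rewrite above (≮⇒≥ l≮y′) | offset-eq j = +-<ᵇ gap (j + y′) l

    depth-letter : ∀ j l → f l ∸ (j + suc y) ≡ l ∸ (j + y′)
    depth-letter j l with l <? y′
    ... | yes l<y′ = trans (m≤n⇒m∸n≡0 (<⇒≤ (below-offset j l<y′)))
                           (sym (m≤n⇒m∸n≡0 (<⇒≤ (<-≤-trans l<y′ (m≤n+m y′ j)))))
    ... | no l≮y′ rewrite above (≮⇒≥ l≮y′) | offset-eq j = [m+n]∸[m+o]≡n∸o gap l (j + y′)

    excess-letter : ∀ l → (f l ∸ y) + [ l <ᵇ y′ ]ᵇ ≡ (l ∸ y′) + 1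
    excess-letter l with l <? y′
    ... | yes l<y′ rewrite m≤n⇒m∸n≡0 (below l<y′) | <⇒<ᵇ-true l<y′ | m≤n⇒m∸n≡0 (<⇒≤ l<y′) = refl
    ... | no l≮y′ rewrite above (≮⇒≥ l≮y′) | ≤⇒<ᵇ-false (≮⇒≥ l≮y′) = begin
      (gap + l ∸ y) + 0              ≡⟨ +-identityʳ _ ⟩
      gap + l ∸ y                    ≡⟨ cong (λ k → gap + k ∸ y) (m+[n∸m]≡n (≮⇒≥ l≮y′)) ⟨
      gap + (y′ + (l ∸ y′)) ∸ y      ≡⟨ cong (_∸ y) (+-assoc gap y′ (l ∸ y′)) ⟨
      (gap + y′) + (l ∸ y′) ∸ y      ≡⟨ cong (λ k → k + (l ∸ y′) ∸ y) gap-eq ⟨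
      suc y + (l ∸ y′) ∸ y           ≡⟨ cong (_∸ y) (+-suc y (l ∸ y′)) ⟨
      y + suc (l ∸ y′) ∸ y           ≡⟨ m+n∸m≡n y _ ⟩
      suc (l ∸ y′)                   ≡⟨ +-comm 1 _ ⟩
      (l ∸ y′) + 1                   ∎
      where open ≡-Reasoning

    sumFrom-shift : ∀ {m} h → (∀ j l → h (j + suc y) (f l) ≡ h (j + y′) l) →
                    ∀ j (g : Vec ℕ m) → sumFrom h (j + suc y) (map f g) ≡ sumFrom h (j + y′) g
    sumFrom-shift h h-letter j [] = refl
    sumFrom-shift h h-letter j (l ∷ w) = cong₂ _+_ (h-letter j l) (sumFrom-shift h h-letter (suc j) w)

    excess-shift : ∀ {m} (g : Vec ℕ m) → excess y (map f g) + countLess y′ g ≡ excess y′ g + m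
    excess-shift [] = refl
    excess-shift {suc m} (l ∷ w) = begin
      ((f l ∸ y) + excess y (map f w)) + ([ l <ᵇ y′ ]ᵇ + countLess y′ w)
        ≡⟨ interchange (f l ∸ y) _ _ _ ⟩
      ((f l ∸ y) + [ l <ᵇ y′ ]ᵇ) + (excess y (map f w) + countLess y′ w)
        ≡⟨ cong₂ _+_ (excess-letter l) (excess-shift w) ⟩
      ((l ∸ y′) + 1) + (excess y′ w + m)
        ≡⟨ interchange (l ∸ y′) 1 _ m ⟩
      ((l ∸ y′) + excess y′ w) + suc m ∎
      where open ≡-Reasoning

  punchIn-shift : ∀ {c y} → c ≤ y → Shift y y (punchIn c)
  punchIn-shift {c} c≤y = record
    { gap      = 1
    ; gap-eq   = refl
    ; above    = λ y≤l → punchIn-≥ (≤-trans c≤y y≤l)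
    ; below    = λ {l} l<y → ≤-trans (punchIn-≤ c l) l<y
    ; monotone = punchIn-<ᵇ c
    }

  relabel-shift : ∀ y st → T (allowed y st) → Shift y (next y st) (relabel y st)
  relabel-shift y (U a) _ = record
    { gap = 0 ; gap-eq = refl ; above = λ _ → refl ; below = ≤-pred ; monotone = λ _ _ → refl }
  relabel-shift (suc k) (D a) ok = record
    { gap      = 2
    ; gap-eq   = refl
    ; above    = λ {l} k≤l → trans (cong (punchIn (suc k)) (punchIn-≥ (≤-trans a≤k k≤l))) (cong suc (punchIn-≥ k≤l))
    ; below    = λ {l} l<k → let p<y = ≤-<-trans (punchIn-≤ a l) (s≤s l<k) in
                               subst (_≤ suc k) (sym (punchIn-< p<y)) (<⇒≤ p<y)
    ; monotone = λ l l′ → trans (punchIn-<ᵇ (suc k) (punchIn a l) (punchIn a l′)) (punchIn-<ᵇ a l l′)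
    }
    where a≤k = ≤-pred (<ᵇ⇒< a (suc k) ok)
  relabel-shift y (H₁ a) _ = punchIn-shift ≤-refl
  relabel-shift y (H₂ a) ok = punchIn-shift (<⇒≤ (<ᵇ⇒< a y ok))
  relabel-shift y H₃ _ = punchIn-shift ≤-refl

  qExp pExp sExp tExp : Mono → ℕ
  qExp (i , _) = i
  pExp (_ , j , _) = j
  sExp (_ , _ , k , _) = k
  tExp (_ , _ , _ , ℓ) = ℓ

  record Balanced {m} (y : ℕ) (g : Vec ℕ m) (μ : Mono) : Set where
    field
      inv-balance   : invWord g + triangle m + triangle (suc y) ≡ qExp μ + excess y g
      fix-balance   : fixFrom y g ≡ pExp μ
      exc-balance   : excFrom y g ≡ sExp μ
      depth-balance : depthFrom y g + triangle m ≡ tExp μ + triangle y + excess y g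

  record StepBalance (y y′ x c : ℕ) (μ : Mono) : Set where
    field
      q-balance : qExp μ + (x ∸ y) + triangle (suc y′) ≡ c + triangle (suc y) + y′
      p-balance : pExp μ ≡ [ x ≡ᵇ y ]ᵇ
      s-balance : sExp μ ≡ [ y <ᵇ x ]ᵇ
      t-balance : tExp μ + triangle y ≡ triangle (suc y′)

  -- L − R = (a₁ − b₁) − (a₂ − b₂) − (a₃ − b₃), written without subtraction.
  cancel-combination : ∀ {L R a₁ b₁ a₂ b₂ a₃ b₃} → a₁ ≡ b₁ → a₂ ≡ b₂ → a₃ ≡ b₃ →
                       L + (b₁ + a₂ + a₃) ≡ R + (a₁ + b₂ + b₃) → L ≡ R
  cancel-combination refl refl refl = +-cancelʳ-≡ _ _ _

  balanced-∷ : ∀ {m y y′ x μ ν} {f : ℕ → ℕ} {g : Vec ℕ m} → Shift y y′ f → Admissible y′ g →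
               StepBalance y y′ x (countLess x (map f g)) μ → Balanced y′ g ν → Balanced y (x ∷ map f g) (μ ⊕ ν)
  balanced-∷ {m} {y} {y′} {x} {μ} {ν} {f} {g} shift adm step bal = record
    { inv-balance   = trans (cong (λ i → c + i + triangle (suc m) + triangle (suc y)) (invWord-map monotone g))
        (cancel-combination inv-balance shifted q-balance
          (solve 12 (λ c I T m B qμ qν X E E′ y′ A →
                       (c :+ I :+ (T :+ m) :+ B) :+ ((qν :+ E′) :+ (E :+ y′) :+ (qμ :+ X :+ A)) :=
                       (qμ :+ qν :+ (X :+ E)) :+ ((I :+ T :+ A) :+ (E′ :+ m) :+ (c :+ B :+ y′)))
                 refl c (invWord g) (triangle m) m (triangle (suc y)) (qExp μ) (qExp ν) (x ∸ y) E (excess y′ g) y′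
                 (triangle (suc y′))))
    ; fix-balance   = cong₂ _+_ (sym p-balance) (trans (sumFrom-shift _ (λ j l → cong [_]ᵇ (fix-letter j l)) 0 g) fix-balance)
    ; exc-balance   = cong₂ _+_ (sym s-balance) (trans (sumFrom-shift _ (λ j l → cong [_]ᵇ (exc-letter j l)) 0 g) exc-balance)
    ; depth-balance = trans (cong (λ d → (x ∸ y) + d + triangle (suc m)) (sumFrom-shift _ depth-letter 0 g))
        (cancel-combination depth-balance t-balance shifted
          (solve 11 (λ X Dp T m tμ tν Ty Ty′ y′ E E′ →
                       (X :+ Dp :+ (T :+ m)) :+ ((tν :+ Ty′ :+ E′) :+ (tμ :+ Ty) :+ (E :+ y′)) :=
                       (tμ :+ tν :+ Ty :+ (X :+ E)) :+ ((Dp :+ T) :+ (Ty′ :+ y′) :+ (E′ :+ m)))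
                 refl (x ∸ y) (depthFrom y′ g) (triangle m) m (tExp μ) (tExp ν) (triangle y) (triangle y′) y′ E (excess y′ g)))
    }
    where
      open Shift shift using (monotone)
      open ShiftProperties shift
      open StepBalance step
      open Balanced bal
      c = countLess x (map f g)
      E = excess y (map f g)
      shifted : E + y′ ≡ excess y′ g + m
      shifted = trans (cong (E +_) (sym (countLess-complete adm ≤-refl))) (excess-shift g)

  record StepEncoding {m} (y : ℕ) (st : Step) (g : Vec ℕ m) : Set where
    field
      admissible : Admissible y (firstLetter y st g ∷ map (relabel y st) g)
      classified : classify y (firstLetter y st g) (map (relabel y st) g) ≡ st
      balance    : StepBalance y (next y st) (firstLetter y st g)
                     (countLess (firstLetter y st g) (map (relabel y st) g)) (stepWeight y st)

  encode-U : ∀ {m y a} {g : Vec ℕ m} → a ≤ y → Admissible (suc y) g → StepEncoding y (U a) g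
  encode-U {m} {y} {a} {g} a≤y adm = record
    { admissible = admissible-∷ id adm (subst (λ w → x ∈ᵇ w ≡ false) (sym (map-id g)) missing) bound id
                     (λ {l} l<y → inj₂ (l , m<n⇒m<1+n l<y , refl))
    ; classified = classified
    ; balance    = record
      { q-balance = trans (sym (+-assoc (a + (x ∸ y)) _ (suc y))) (cong (λ c → c + triangle (suc y) + suc y) (sym count))
      ; p-balance = cong [_]ᵇ (sym (≢⇒≡ᵇ-false (>⇒≢ y<x)))
      ; s-balance = cong [_]ᵇ (sym (<⇒<ᵇ-true y<x))
      ; t-balance = solve 2 (λ y T → (y :+ (con 1 :+ (y :+ con 0))) :+ T := T :+ y :+ (con 1 :+ y)) refl y (triangle y)
      }
    }
    where
      x = nthMissing g (suc y + m) (y ∸ a)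
      open IsNthMissing (nthMissing-admissible adm (s≤s (m∸n≤m y a)))
      y<x = missing⇒≥ adm missing
      count : countLess x (map id g) ≡ a + (x ∸ y)
      count = trans (cong (countLess x) (map-id g)) (countLess-rank (Admissible.distinct adm) rank a≤y (<⇒≤ y<x))
      classified : classify y x (map id g) ≡ U a
      classified rewrite ≢⇒≡ᵇ-false (>⇒≢ y<x) | <⇒<ᵇ-true y<x | map-id g | Admissible.complete adm (n<1+n y)
        = cong U (trans (cong (y ∸_) rank) (m∸[m∸n]≡n a≤y))

  encode-D : ∀ {m k a} {g : Vec ℕ m} → a ≤ k → Admissible k g → StepEncoding (suc k) (D a) g
  encode-D {m} {k} {a} {g} a≤k adm = record
    { admissible = admissible-∷ (relabel-injective (suc k) (D a)) adm (∉-map relabel≢a g)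
                     (s≤s (≤-trans (m≤n⇒m≤1+n a≤k) (m≤m+n (suc k) m)))
                     (λ {l} l<k+m → punchIn-bounded (suc k) (punchIn-bounded a l<k+m)) below
    ; classified = classified
    ; balance    = record
      { q-balance = q-balance
      ; p-balance = cong [_]ᵇ (sym (≢⇒≡ᵇ-false (<⇒≢ (s≤s a≤k))))
      ; s-balance = cong [_]ᵇ (sym (≤⇒<ᵇ-false (m≤n⇒m≤1+n a≤k)))
      ; t-balance = refl
      }
    }
    where
      count : countLess a (map (relabel (suc k) (D a)) g) ≡ a
      count = trans (countLess-map (λ l → trans (punchIn-<ᵇ-below (suc k) (punchIn a l) (m≤n⇒m≤1+n a≤k))
                                                (punchIn-<ᵇ-below a l ≤-refl)) g)
                    (countLess-complete adm a≤k)
      q-balance : (k + suc (k + 0) + a) + (a ∸ suc k) + triangle (suc k) ≡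
                  countLess a (map (relabel (suc k) (D a)) g) + triangle (suc (suc k)) + k
      q-balance rewrite m≤n⇒m∸n≡0 (m≤n⇒m≤1+n a≤k) | count =
        solve 3 (λ k a T → (k :+ (con 1 :+ (k :+ con 0)) :+ a) :+ con 0 :+ T := a :+ (T :+ (con 1 :+ k)) :+ k)
              refl k a (triangle (suc k))
      relabel≢a : ∀ l → punchIn (suc k) (punchIn a l) ≢ a
      relabel≢a l with punchIn a l <? suc k
      ... | yes p<1+k rewrite punchIn-< p<1+k = punchInᵢ≢i a l
      ... | no p≮1+k rewrite punchIn-≥ (≮⇒≥ p≮1+k) = >⇒≢ (s≤s (≤-trans (m≤n⇒m≤1+n a≤k) (≮⇒≥ p≮1+k)))
      below : ∀ {l} → l < suc k → l ≡ a ⊎ ∃[ l′ ] (l′ < k × punchIn (suc k) (punchIn a l′) ≡ l)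
      below {l} l<1+k with l ≟ a
      ... | yes l≡a = inj₁ l≡a
      ... | no l≢a = inj₂ (punchOut a l , punchOut-bounded a≤k l<1+k l≢a ,
                           trans (cong (punchIn (suc k)) (punchIn-punchOut l≢a)) (punchIn-< l<1+k))
      classified : classify (suc k) a (map (relabel (suc k) (D a)) g) ≡ D a
      classified rewrite ≢⇒≡ᵇ-false (<⇒≢ (s≤s a≤k)) | ≤⇒<ᵇ-false (m≤n⇒m≤1+n a≤k)
                       | ∉-map (λ l → punchInᵢ≢i (suc k) (punchIn a l)) g = refl

  encode-H₁ : ∀ {m k a} {g : Vec ℕ m} → a ≤ k → Admissible (suc k) g → StepEncoding (suc k) (H₁ a) g
  encode-H₁ {m} {k} {a} {g} a≤k adm = record
    { admissible = admissible-∷ (punchIn-injective y) adm (trans (∈ᵇ-map (punchIn-injective y) x′ g) missing)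
                     (punchIn-bounded y bound) (punchIn-bounded y) (λ {l} l<y → inj₂ (l , l<y , punchIn-< l<y))
    ; classified = classified
    ; balance    = record
      { q-balance = q-balance
      ; p-balance = cong [_]ᵇ (sym (≢⇒≡ᵇ-false (punchInᵢ≢i y x′)))
      ; s-balance = cong [_]ᵇ (sym (<⇒<ᵇ-true y<x))
      ; t-balance = +-comm y (triangle y)
      }
    }
    where
      y = suc k
      x′ = nthMissing g (y + m) (k ∸ a)
      open IsNthMissing (nthMissing-admissible adm (s≤s (m∸n≤m k a)))
      count : countLess (punchIn y x′) (map (punchIn y) g) ≡ a + (x′ ∸ k)
      count = trans (countLess-map (λ l → punchIn-<ᵇ y l x′) g)
                    (countLess-rank (Admissible.distinct adm) rank a≤k (≤-pred (m≤n⇒m≤1+n (missing⇒≥ adm missing))))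
      q-balance : (y + a) + (punchIn y x′ ∸ y) + triangle (suc y) ≡
                  countLess (punchIn y x′) (map (punchIn y) g) + triangle (suc y) + y
      q-balance rewrite count | punchIn-≥ (missing⇒≥ adm missing) =
        solve 4 (λ k a X T → (con 1 :+ k :+ a) :+ X :+ T := (a :+ X) :+ T :+ (con 1 :+ k)) refl k a (x′ ∸ k) (triangle (suc y))
      y<x : y < punchIn y x′
      y<x = subst (y <_) (sym (punchIn-≥ (missing⇒≥ adm missing))) (s≤s (missing⇒≥ adm missing))
      classified : classify y (punchIn y x′) (map (punchIn y) g) ≡ H₁ a
      classified rewrite ≢⇒≡ᵇ-false (punchInᵢ≢i y x′) | <⇒<ᵇ-true y<x | ∉-map (punchInᵢ≢i y) g
                       | map-unrelabel-relabel y (H₁ a) g | punchOut-punchIn y x′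
        = cong H₁ (trans (cong (k ∸_) rank) (m∸[m∸n]≡n a≤k))

  encode-H₂ : ∀ {m k a} {g : Vec ℕ m} → a ≤ k → Admissible (suc k) g → StepEncoding (suc k) (H₂ a) g
  encode-H₂ {m} {k} {a} {g} a≤k adm = record
    { admissible = admissible-∷ (punchIn-injective a) adm (∉-map (punchInᵢ≢i a) g)
                     (s≤s (≤-trans (m≤n⇒m≤1+n a≤k) (m≤m+n (suc k) m)))
                     (punchIn-bounded a) below
    ; classified = classified
    ; balance    = record
      { q-balance = q-balance
      ; p-balance = cong [_]ᵇ (sym (≢⇒≡ᵇ-false (<⇒≢ (s≤s a≤k))))
      ; s-balance = cong [_]ᵇ (sym (≤⇒<ᵇ-false (m≤n⇒m≤1+n a≤k)))
      ; t-balance = +-comm (suc k) (triangle (suc k))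
      }
    }
    where
      count : countLess a (map (punchIn a) g) ≡ a
      count = trans (countLess-map (λ l → punchIn-<ᵇ-below a l ≤-refl) g) (countLess-complete adm (m≤n⇒m≤1+n a≤k))
      q-balance : (suc k + a) + (a ∸ suc k) + triangle (suc (suc k)) ≡
                  countLess a (map (punchIn a) g) + triangle (suc (suc k)) + suc k
      q-balance rewrite m≤n⇒m∸n≡0 (m≤n⇒m≤1+n a≤k) | count =
        solve 3 (λ k a T → (con 1 :+ k :+ a) :+ con 0 :+ T := a :+ T :+ (con 1 :+ k)) refl k a (triangle (suc (suc k)))
      below : ∀ {l} → l < suc k → l ≡ a ⊎ ∃[ l′ ] (l′ < suc k × punchIn a l′ ≡ l)
      below {l} l<1+k with l ≟ a
      ... | yes l≡a = inj₁ l≡a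
      ... | no l≢a = inj₂ (punchOut a l , punchOut-bounded (m≤n⇒m≤1+n a≤k) (m<n⇒m<1+n l<1+k) l≢a , punchIn-punchOut l≢a)
      y∈g : suc k ∈ᵇ map (punchIn a) g ≡ true
      y∈g = trans (cong (_∈ᵇ map (punchIn a) g) (sym (punchIn-≥ a≤k)))
                  (trans (∈ᵇ-map (punchIn-injective a) k g) (Admissible.complete adm (n<1+n k)))
      classified : classify (suc k) a (map (punchIn a) g) ≡ H₂ a
      classified rewrite ≢⇒≡ᵇ-false (<⇒≢ (s≤s a≤k)) | ≤⇒<ᵇ-false (m≤n⇒m≤1+n a≤k) | y∈g = refl

  encode-H₃ : ∀ {m y} {g : Vec ℕ m} → Admissible y g → StepEncoding y H₃ g
  encode-H₃ {m} {y} {g} adm = record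
    { admissible = admissible-∷ (punchIn-injective y) adm (∉-map (punchInᵢ≢i y) g) (s≤s (m≤m+n y m))
                     (punchIn-bounded y) (λ {l} l<y → inj₂ (l , l<y , punchIn-< l<y))
    ; classified = classified
    ; balance    = record
      { q-balance = q-balance
      ; p-balance = cong [_]ᵇ (sym (≡ᵇ-refl y))
      ; s-balance = cong [_]ᵇ (sym (≤⇒<ᵇ-false (≤-refl {y})))
      ; t-balance = +-comm y (triangle y)
      }
    }
    where
      count : countLess y (map (punchIn y) g) ≡ y
      count = trans (countLess-map (λ l → punchIn-<ᵇ-below y l ≤-refl) g) (countLess-complete adm ≤-refl)
      q-balance : (y + (y + 0)) + (y ∸ y) + triangle (suc y) ≡ countLess y (map (punchIn y) g) + triangle (suc y) + y
      q-balance rewrite n∸n≡0 y | count = solve 2 (λ y T → (y :+ (y :+ con 0)) :+ con 0 :+ T := y :+ T :+ y) refl y (triangle (suc y))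
      classified : classify y y (map (punchIn y) g) ≡ H₃
      classified rewrite ≡ᵇ-refl y = refl

  encode-step : ∀ {m} y st {g : Vec ℕ m} → T (allowed y st) → Admissible (next y st) g → StepEncoding y st g
  encode-step y (U a) ok = encode-U (≤-pred (<ᵇ⇒< a (suc y) ok))
  encode-step (suc k) (D a) ok = encode-D (≤-pred (<ᵇ⇒< a (suc k) ok))
  encode-step (suc k) (H₁ a) ok = encode-H₁ (≤-pred (<ᵇ⇒< a (suc k) ok))
  encode-step (suc k) (H₂ a) ok = encode-H₂ (≤-pred (<ᵇ⇒< a (suc k) ok))
  encode-step y H₃ _ = encode-H₃

  encode-admissible : ∀ {m} y (v : Vec Step m) → T (validFrom y (toList v)) → Admissible y (encode y v)
  encode-admissible zero [] _ = record { distinct = _ ; bounded = [] ; complete = λ () }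
  encode-admissible y (st ∷ v) valid
    with ok , valid′ ← Equivalence.to T-∧ (subst T (validFrom-∷ y st (toList v)) valid)
    = StepEncoding.admissible (encode-step y st ok (encode-admissible (next y st) v valid′))

  decode-encode : ∀ {m} y (v : Vec Step m) → T (validFrom y (toList v)) → decode y (encode y v) ≡ v
  decode-encode zero [] _ = refl
  decode-encode y (st ∷ v) valid
    with ok , valid′ ← Equivalence.to T-∧ (subst T (validFrom-∷ y st (toList v)) valid)
    rewrite StepEncoding.classified (encode-step y st ok (encode-admissible (next y st) v valid′))
          | map-unrelabel-relabel y st (encode (next y st) v)
    = cong (st ∷_) (decode-encode (next y st) v valid′)

  encode-balanced : ∀ {m} y (v : Vec Step m) → T (validFrom y (toList v)) →
                    Balanced y (encode y v) (weightFrom y (toList v))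
  encode-balanced zero [] _ = record { inv-balance = refl ; fix-balance = refl ; exc-balance = refl ; depth-balance = refl }
  encode-balanced y (st ∷ v) valid
    with ok , valid′ ← Equivalence.to T-∧ (subst T (validFrom-∷ y st (toList v)) valid)
    rewrite weightFrom-∷ y st (toList v)
    = balanced-∷ (relabel-shift y st ok) (encode-admissible (next y st) v valid′)
        (StepEncoding.balance (encode-step y st ok (encode-admissible (next y st) v valid′)))
        (encode-balanced (next y st) v valid′)

  record StepDecoding {m} (y x : ℕ) (w : Vec ℕ m) (st : Step) : Set where
    field
      allowed-step    : T (allowed y st)
      tail-admissible : Admissible (next y st) (map (unrelabel y st) w)
      first-letter    : firstLetter y st (map (unrelabel y st) w) ≡ x
      relabel-tail    : map (relabel y st) (map (unrelabel y st) w) ≡ w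

  decode-H₃ : ∀ {m y} {w : Vec ℕ m} → Admissible y (y ∷ w) → StepDecoding y y w H₃
  decode-H₃ {m} {y} {w} adm = record
    { allowed-step    = _
    ; tail-admissible = admissible-∷⁻ (punchIn-injective y) (subst (λ w′ → Admissible y (y ∷ w′)) (sym relabel-tail) adm)
                          (punchIn-bounded⁻ (m≤m+n y m))
                          (λ {l} l<y → inj₁ (punchInᵢ≢i y l , subst (_< y) (sym (punchIn-< l<y)) l<y))
    ; first-letter    = refl
    ; relabel-tail    = relabel-tail
    }
    where
      relabel-tail = punchIn-punchOut-avoiding w (proj₁ (Admissible.distinct adm))

  decode-U : ∀ {m y x} {w : Vec ℕ m} → Admissible y (x ∷ w) → y < x → y ∈ᵇ w ≡ true →
             StepDecoding y x w (U (y ∸ missingBelow w x))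
  decode-U {m} {y} {x} {w} adm y<x y∈w = record
    { allowed-step    = <⇒<ᵇ (s≤s (m∸n≤m y (missingBelow w x)))
    ; tail-admissible = subst (Admissible (suc y)) (sym (map-id w)) tail-admissible
    ; first-letter    = first-letter
    ; relabel-tail    = trans (map-id _) (map-id w)
    }
    where
      open Admissible adm
      tail-admissible : Admissible (suc y) w
      tail-admissible = record
        { distinct = proj₂ distinct
        ; bounded  = subst (λ N → All (_< N) w) (+-suc y m) (All.tail bounded)
        ; complete = complete′
        }
        where
          complete′ : ∀ {l} → l < suc y → l ∈ᵇ w ≡ true
          complete′ {l} l<1+y with m≤n⇒m<n∨m≡n (≤-pred l<1+y)
          ... | inj₁ l<y = ∈ᵇ-∷⁻ w (complete l<y) (<⇒≢ (<-trans l<y y<x))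
          ... | inj₂ refl = y∈w
      x<bound : x < suc y + m
      x<bound = subst (x <_) (+-suc y m) (All.head bounded)
      rank≤y : missingBelow w x ≤ y
      rank≤y = ≤-pred (subst (missingBelow w x <_) (missingBelow-total tail-admissible)
                             (missingBelow-< w (proj₁ distinct) x<bound))
      first-letter : nthMissing (map id w) (suc y + m) (y ∸ (y ∸ missingBelow w x)) ≡ x
      first-letter rewrite map-id w | m∸[m∸n]≡n rank≤y = nthMissing-missingBelow w _ (proj₁ distinct) x<bound

  decode-H₁ : ∀ {m k x} {w : Vec ℕ m} → Admissible (suc k) (x ∷ w) → suc k < x → suc k ∈ᵇ w ≡ false →
              StepDecoding (suc k) x w (H₁ (k ∸ missingBelow (map (punchOut (suc k)) w) (punchOut (suc k) x)))
  decode-H₁ {m} {k} {x} {w} adm y<x y∉w = record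
    { allowed-step    = <⇒<ᵇ (s≤s (m∸n≤m k rank))
    ; tail-admissible = tail-admissible
    ; first-letter    = first-letter
    ; relabel-tail    = relabel-tail
    }
    where
      y = suc k
      w′ = map (punchOut y) w
      x′ = punchOut y x
      rank = missingBelow w′ x′
      relabel-tail = punchIn-punchOut-avoiding w y∉w
      x≢y = >⇒≢ y<x
      tail-admissible : Admissible y w′
      tail-admissible = admissible-∷⁻ (punchIn-injective y) (subst (λ u → Admissible y (x ∷ u)) (sym relabel-tail) adm)
        (punchIn-bounded⁻ (m≤m+n y m))
        (λ {l} l<y → inj₁ (subst (_≢ x) (sym (punchIn-< l<y)) (<⇒≢ (<-trans l<y y<x)) , subst (_< y) (sym (punchIn-< l<y)) l<y))
      x′∉w′ : x′ ∈ᵇ w′ ≡ false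
      x′∉w′ = trans (sym (∈ᵇ-map (punchIn-injective y) x′ w′))
                    (trans (cong₂ _∈ᵇ_ (punchIn-punchOut x≢y) relabel-tail) (proj₁ (Admissible.distinct adm)))
      x′<bound : x′ < y + m
      x′<bound = punchOut-bounded (m≤m+n y m) (subst (x <_) (+-suc y m) (All.head (Admissible.bounded adm))) x≢y
      rank≤k : rank ≤ k
      rank≤k = ≤-pred (subst (rank <_) (missingBelow-total tail-admissible) (missingBelow-< w′ x′∉w′ x′<bound))
      first-letter : punchIn y (nthMissing w′ (y + m) (k ∸ (k ∸ rank))) ≡ x
      first-letter rewrite m∸[m∸n]≡n rank≤k | nthMissing-missingBelow w′ (y + m) x′∉w′ x′<bound = punchIn-punchOut x≢y

  decode-H₂ : ∀ {m y x} {w : Vec ℕ m} → Admissible y (x ∷ w) → x < y → y ∈ᵇ w ≡ true → StepDecoding y x w (H₂ x)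
  decode-H₂ {m} {y} {x} {w} adm x<y y∈w = record
    { allowed-step    = <⇒<ᵇ x<y
    ; tail-admissible = admissible-∷⁻ (punchIn-injective x) (subst (λ u → Admissible y (x ∷ u)) (sym relabel-tail) adm)
                          (punchIn-bounded⁻ (≤-trans (<⇒≤ x<y) (m≤m+n y m))) below
    ; first-letter    = refl
    ; relabel-tail    = relabel-tail
    }
    where
      relabel-tail = punchIn-punchOut-avoiding w (proj₁ (Admissible.distinct adm))
      below : ∀ {l} → l < y →
              (punchIn x l ≢ x × punchIn x l < y) ⊎ punchIn x l ∈ᵇ map (punchIn x) (map (punchOut x) w) ≡ true
      below {l} l<y with punchIn x l <? y
      ... | yes p<y = inj₁ (punchInᵢ≢i x l , p<y)
      ... | no p≮y rewrite ≤-antisym (≤-trans (punchIn-≤ x l) l<y) (≮⇒≥ p≮y) | relabel-tail = inj₂ y∈w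

  decode-D : ∀ {m k x} {w : Vec ℕ m} → Admissible (suc k) (x ∷ w) → x < suc k → suc k ∈ᵇ w ≡ false →
             StepDecoding (suc k) x w (D x)
  decode-D {m} {k} {x} {w} adm x<y y∉w = record
    { allowed-step    = <⇒<ᵇ x<y
    ; tail-admissible = admissible-∷⁻ (relabel-injective y (D x)) (subst (λ u → Admissible y (x ∷ u)) (sym relabel-tail) adm)
                          (punchIn-bounded⁻ (≤-trans (≤-pred x<y) (m≤m+n k m)) ∘ punchIn-bounded⁻ (m≤m+n y m)) below
    ; first-letter    = refl
    ; relabel-tail    = relabel-tail
    }
    where
      y = suc k
      x∉w = proj₁ (Admissible.distinct adm)
      relabel-tail : map (relabel y (D x)) (map (unrelabel y (D x)) w) ≡ w
      relabel-tail = trans (sym (map-∘ _ _ w)) (map-fixes (All.map fixes (All.zip (∉⇒All≢ w x∉w , ∉⇒All≢ w y∉w))))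
        where
          fixes : ∀ {l} → l ≢ x × l ≢ y → punchIn y (punchIn x (punchOut x (punchOut y l))) ≡ l
          fixes (l≢x , l≢y) = trans (cong (punchIn y) (punchIn-punchOut (punchOut≢ x<y l≢x l≢y))) (punchIn-punchOut l≢y)
      below : ∀ {l} → l < k → (relabel y (D x) l ≢ x × relabel y (D x) l < y) ⊎ _
      below {l} l<k = inj₁ (subst (_≢ x) (sym fl≡) (punchInᵢ≢i x l) , subst (_< y) (sym fl≡) p<y)
        where
          p<y : punchIn x l < y
          p<y = ≤-<-trans (punchIn-≤ x l) (s≤s l<k)
          fl≡ : punchIn y (punchIn x l) ≡ punchIn x l
          fl≡ = punchIn-< p<y

  no-H₁-at-0 : ∀ {m x} {w : Vec ℕ m} → Admissible 0 (x ∷ w) → 0 < x → 0 ∈ᵇ w ≡ false → ⊥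
  no-H₁-at-0 {m} {x} {w} adm 0<x 0∉w = <-irrefl (sym (missingBelow-total adm))
    (missingBelow-< {N = suc m} (x ∷ w) 0∉x∷w (s≤s z≤n))
    where
      0∉x∷w : 0 ∈ᵇ (x ∷ w) ≡ false
      0∉x∷w rewrite ≢⇒≡ᵇ-false (<⇒≢ 0<x) = 0∉w

  decode-step : ∀ {m y x} {w : Vec ℕ m} → Admissible y (x ∷ w) → StepDecoding y x w (classify y x w)
  decode-step {y = y} {x} {w} adm with <-cmp x y | y ∈ᵇ w in y∈w
  ... | tri≈ _ refl _ | _ rewrite ≡ᵇ-refl x = decode-H₃ adm
  ... | tri> _ x≢y y<x | true rewrite ≢⇒≡ᵇ-false x≢y | <⇒<ᵇ-true y<x = decode-U adm y<x y∈w
  decode-step {y = zero} adm | tri> _ _ 0<x | false = ⊥-elim (no-H₁-at-0 adm 0<x y∈w)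
  decode-step {y = suc k} adm | tri> _ x≢y y<x | false
    rewrite ≢⇒≡ᵇ-false x≢y | <⇒<ᵇ-true y<x = decode-H₁ adm y<x y∈w
  decode-step {y = suc k} adm | tri< x<y x≢y _ | true
    rewrite ≢⇒≡ᵇ-false x≢y | ≤⇒<ᵇ-false (<⇒≤ x<y) = decode-H₂ adm x<y y∈w
  decode-step {y = suc k} adm | tri< x<y x≢y _ | false
    rewrite ≢⇒≡ᵇ-false x≢y | ≤⇒<ᵇ-false (<⇒≤ x<y) = decode-D adm x<y y∈w

  decode-valid : ∀ {m} y (g : Vec ℕ m) → Admissible y g → T (validFrom y (toList (decode y g)))
  decode-valid zero [] _ = _
  decode-valid (suc y) [] adm = contradiction (Admissible.complete adm z<s) λ ()
  decode-valid y (x ∷ w) adm = subst T (sym (validFrom-∷ y st (toList (decode (next y st) _))))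
    (Equivalence.from T-∧ (allowed-step , decode-valid (next y st) _ tail-admissible))
    where
      st = classify y x w
      open StepDecoding (decode-step adm)

  encode-decode : ∀ {m} y (g : Vec ℕ m) → Admissible y g → encode y (decode y g) ≡ g
  encode-decode y [] _ = refl
  encode-decode y (x ∷ w) adm = begin
    firstLetter y st (encode _ (decode _ g)) ∷ map (relabel y st) (encode _ (decode _ g))
      ≡⟨ cong (λ u → firstLetter y st u ∷ map (relabel y st) u) (encode-decode (next y st) g tail-admissible) ⟩
    firstLetter y st g ∷ map (relabel y st) g
      ≡⟨ cong₂ _∷_ first-letter relabel-tail ⟩
    x ∷ w ∎
    where
      open ≡-Reasoning
      st = classify y x w
      g = map (unrelabel y st) w
      open StepDecoding (decode-step adm)

  -- Permutations

  sumFin-tabulate : ∀ {A : Set} n (h : A → ℕ) (g : Fin n → A) →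
                    foldr (λ i acc → h i + acc) 0 (tabulate g) ≡ sumFin n (h ∘ g)
  sumFin-tabulate zero h g = refl
  sumFin-tabulate (suc n) h g =
    cong (h (g fzero) +_) (trans (sumFin-tabulate n h (g ∘ fsuc)) (sym (sumFin-tabulate n (h ∘ g) fsuc)))

  sumFin-suc : ∀ n (f : Fin (suc n) → ℕ) → sumFin (suc n) f ≡ f fzero + sumFin n (f ∘ fsuc)
  sumFin-suc n f = cong (f fzero +_) (sumFin-tabulate n f fsuc)

  sumFin-cong : ∀ n {f g : Fin n → ℕ} → (∀ i → f i ≡ g i) → sumFin n f ≡ sumFin n g
  sumFin-cong zero f≡g = refl
  sumFin-cong (suc n) {f} {g} f≡g = begin
    sumFin (suc n) f             ≡⟨ sumFin-suc n f ⟩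
    f fzero + sumFin n (f ∘ fsuc) ≡⟨ cong₂ _+_ (f≡g fzero) (sumFin-cong n (f≡g ∘ fsuc)) ⟩
    g fzero + sumFin n (g ∘ fsuc) ≡⟨ sumFin-suc n g ⟨
    sumFin (suc n) g             ∎
    where open ≡-Reasoning

  sumFin-sumFrom : ∀ {N m} h y (w : Vec (Fin N) m) →
                   sumFin m (λ i → h (y + toℕ i) (toℕ (lookup w i))) ≡ sumFrom h y (map toℕ w)
  sumFin-sumFrom h y [] = refl
  sumFin-sumFrom {m = suc m} h y (x ∷ w) = trans (sumFin-suc m _) (cong₂ _+_
    (cong (λ p → h p (toℕ x)) (+-identityʳ y))
    (trans (sumFin-cong m (λ i → cong (λ p → h p (toℕ (lookup w i))) (+-suc y (toℕ i)))) (sumFin-sumFrom h (suc y) w)))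

  sumFin-countLess : ∀ {N m} x (w : Vec (Fin N) m) → sumFin m (λ j → [ toℕ (lookup w j) <ᵇ x ]ᵇ) ≡ countLess x (map toℕ w)
  sumFin-countLess x [] = refl
  sumFin-countLess {m = suc m} x (l ∷ w) = trans (sumFin-suc m _) (cong ([ toℕ l <ᵇ x ]ᵇ +_) (sumFin-countLess x w))

  inversionCount : ∀ {N m} → Vec (Fin N) m → Fin m → Fin m → ℕ
  inversionCount w i j = [ (toℕ i <ᵇ toℕ j) ∧ (toℕ (lookup w j) <ᵇ toℕ (lookup w i)) ]ᵇ

  inv-invWord : ∀ {N m} (w : Vec (Fin N) m) → sumFin m (λ i → sumFin m (inversionCount w i)) ≡ invWord (map toℕ w)
  inv-invWord [] = refl
  inv-invWord {m = suc m} (x ∷ w) = trans (sumFin-suc m _) (cong₂ _+_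
    (trans (sumFin-suc m (inversionCount (x ∷ w) fzero)) (sumFin-countLess (toℕ x) w))
    (trans (sumFin-cong m (λ i → sumFin-suc m (inversionCount (x ∷ w) (fsuc i)))) (inv-invWord w)))

  depth-depthFrom : ∀ {n} (σ : Vec (Fin n) n) → depth σ ≡ depthFrom 0 (map toℕ σ)
  depth-depthFrom {n} σ =
    trans (sumFin-cong n (λ i → if-<ᵇ-∸ (toℕ i) (toℕ (lookup σ i)))) (sumFin-sumFrom (λ i x → x ∸ i) 0 σ)
    where
      if-<ᵇ-∸ : ∀ a b → (if a <ᵇ b then b ∸ a else 0) ≡ b ∸ a
      if-<ᵇ-∸ a b with a <ᵇ b in a<ᵇb
      ... | true = refl
      ... | false = sym (m≤n⇒m∸n≡0 (<ᵇ-false⇒≥ {a} {b} a<ᵇb))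

  distinctPairᵇ : ∀ {N m} → Vec (Fin N) m → Fin m → Fin m → Bool
  distinctPairᵇ w i j = not ((toℕ i <ᵇ toℕ j) ∧ (toℕ (lookup w i) ≡ᵇ toℕ (lookup w j)))

  pairwiseDistinctᵇ : ∀ {N m} → Vec (Fin N) m → Bool
  pairwiseDistinctᵇ w = and (tabulate λ i → and (tabulate (distinctPairᵇ w i)))

  and-++ : ∀ xs ys → and (xs ++ ys) ≡ and xs ∧ and ys
  and-++ [] ys = refl
  and-++ (true ∷ xs) ys = and-++ xs ys
  and-++ (false ∷ xs) ys = refl

  and-concatMap : ∀ {A : Set} (f : A → List Bool) xs → and (concatMap f xs) ≡ and (List.map (and ∘ f) xs)
  and-concatMap f [] = refl
  and-concatMap f (x ∷ xs) = trans (and-++ (f x) _) (cong (and (f x) ∧_) (and-concatMap f xs))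

  isPermᵇ-pairwise : ∀ {n} (σ : Vec (Fin n) n) → isPermᵇ σ ≡ pairwiseDistinctᵇ σ
  isPermᵇ-pairwise {n} σ = trans (and-concatMap _ (List.allFin n))
    (cong and (trans (map-tabulate id (λ i → and (List.map (distinctPairᵇ σ i) (List.allFin n))))
                      (tabulate-cong (λ i → cong and (map-tabulate id (distinctPairᵇ σ i))))))

  ∉ᵇ-tabulate : ∀ {N m} x (w : Vec (Fin N) m) →
                and (tabulate λ j → not (x ≡ᵇ toℕ (lookup w j))) ≡ not (x ∈ᵇ map toℕ w)
  ∉ᵇ-tabulate x [] = refl
  ∉ᵇ-tabulate x (l ∷ w) with x ≡ᵇ toℕ l
  ... | true = refl
  ... | false = ∉ᵇ-tabulate x w

  pairwiseDistinctᵇ⇒Distinct : ∀ {N m} (w : Vec (Fin N) m) → T (pairwiseDistinctᵇ w) → Distinct (map toℕ w)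
  pairwiseDistinctᵇ⇒Distinct [] _ = _
  pairwiseDistinctᵇ⇒Distinct (x ∷ w) distinct
    with x∉w , distinct′ ← Equivalence.to T-∧ distinct
    = Equivalence.to T-not-≡ (subst T (∉ᵇ-tabulate (toℕ x) w) x∉w) , pairwiseDistinctᵇ⇒Distinct w distinct′

  Distinct⇒pairwiseDistinctᵇ : ∀ {N m} (w : Vec (Fin N) m) → Distinct (map toℕ w) → T (pairwiseDistinctᵇ w)
  Distinct⇒pairwiseDistinctᵇ [] _ = _
  Distinct⇒pairwiseDistinctᵇ (x ∷ w) (x∉w , distinct) = Equivalence.from T-∧
    (subst T (sym (∉ᵇ-tabulate (toℕ x) w)) (Equivalence.from T-not-≡ x∉w) , Distinct⇒pairwiseDistinctᵇ w distinct)

  excess-sumℕ : ∀ {m N} (g : Vec ℕ m) → Distinct g → All (_< N) g → excess 0 g ≡ sumℕ N (λ l → [ l ∈ᵇ g ]ᵇ * l)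
  excess-sumℕ {N = N} [] _ _ = sym (sumℕ-zero N (λ _ → refl))
  excess-sumℕ {N = N} (x ∷ w) (x∉w , distinct) (x<N ∷ bounded) = begin
    x + excess 0 w
      ≡⟨ cong₂ _+_ (sym (sumℕ-point N x<N)) (excess-sumℕ w distinct bounded) ⟩
    sumℕ N (λ l → [ l ≡ᵇ x ]ᵇ * l) + sumℕ N (λ l → [ l ∈ᵇ w ]ᵇ * l)
      ≡⟨ sumℕ-+ N _ _ ⟨
    sumℕ N (λ l → [ l ≡ᵇ x ]ᵇ * l + [ l ∈ᵇ w ]ᵇ * l)
      ≡⟨ sumℕ-cong N (λ {l} _ → indicator-∨ l) ⟩
    sumℕ N (λ l → [ (l ≡ᵇ x) ∨ (l ∈ᵇ w) ]ᵇ * l) ∎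
    where
      open ≡-Reasoning
      indicator-∨ : ∀ l → [ l ≡ᵇ x ]ᵇ * l + [ l ∈ᵇ w ]ᵇ * l ≡ [ (l ≡ᵇ x) ∨ (l ∈ᵇ w) ]ᵇ * l
      indicator-∨ l with l ≡ᵇ x in l≡ᵇx
      ... | false = refl
      ... | true rewrite ≡ᵇ⇒≡ l x (subst T (sym l≡ᵇx) _) | x∉w = +-identityʳ _

  excess-permutation : ∀ {m} {g : Vec ℕ m} → Admissible 0 g → excess 0 g ≡ triangle m
  excess-permutation {m} {g} adm = begin
    excess 0 g                             ≡⟨ excess-sumℕ g distinct bounded ⟩
    sumℕ m (λ l → [ l ∈ᵇ g ]ᵇ * l)          ≡⟨ sumℕ-cong m (λ {l} l<m → cong (λ b → [ b ]ᵇ * l) (present l<m)) ⟩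
    sumℕ m (λ l → 1 * l)                    ≡⟨ sumℕ-identity m ⟩
    triangle m                             ∎
    where
      open ≡-Reasoning
      open Admissible adm
      present : ∀ {l} → l < m → l ∈ᵇ g ≡ true
      present {l} l<m with l ∈ᵇ g | sumℕ-zero⁻ m (missingBelow-total adm) l<m
      ... | true | _ = refl
      sumℕ-identity : ∀ n → sumℕ n (λ l → 1 * l) ≡ triangle n
      sumℕ-identity zero = refl
      sumℕ-identity (suc n) = cong₂ _+_ (sumℕ-identity n) (+-identityʳ n)

  balanced-permutation : ∀ {m μ} {g : Vec ℕ m} → Admissible 0 g → Balanced 0 g μ →
                         μ ≡ (invWord g , fixFrom 0 g , excFrom 0 g , depthFrom 0 g)
  balanced-permutation {m} {μ} {g} adm bal =
    cong₂ _,_ q-exponent (cong₂ _,_ (sym fix-balance) (cong₂ _,_ (sym exc-balance) t-exponent))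
    where
      open Balanced bal
      q-exponent : qExp μ ≡ invWord g
      q-exponent = +-cancelʳ-≡ (triangle m) _ _ (begin
        qExp μ + triangle m            ≡⟨ cong (qExp μ +_) (excess-permutation adm) ⟨
        qExp μ + excess 0 g            ≡⟨ inv-balance ⟨
        invWord g + triangle m + 0     ≡⟨ +-identityʳ _ ⟩
        invWord g + triangle m         ∎)
        where open ≡-Reasoning
      t-exponent : tExp μ ≡ depthFrom 0 g
      t-exponent = +-cancelʳ-≡ (triangle m) _ _ (begin
        tExp μ + triangle m            ≡⟨ cong (tExp μ +_) (excess-permutation adm) ⟨
        tExp μ + excess 0 g            ≡⟨ cong (_+ excess 0 g) (+-identityʳ _) ⟨
        tExp μ + 0 + excess 0 g        ≡⟨ depth-balance ⟨
        depthFrom 0 g + triangle m     ∎)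
        where open ≡-Reasoning

  permutation-admissible : ∀ {n} (σ : Vec (Fin n) n) → T (isPermᵇ σ) → Admissible 0 (map toℕ σ)
  permutation-admissible σ isPerm = record
    { distinct = pairwiseDistinctᵇ⇒Distinct σ (subst T (isPermᵇ-pairwise σ) isPerm)
    ; bounded  = map⁺ (All.universal toℕ<n σ)
    ; complete = λ ()
    }

  fromℕs : ∀ {m N} (g : Vec ℕ m) → All (_< N) g → Vec (Fin N) m
  fromℕs [] [] = []
  fromℕs (x ∷ w) (x<N ∷ bounded) = fromℕ< x<N ∷ fromℕs w bounded

  toℕ-fromℕs : ∀ {m N} (g : Vec ℕ m) (bounded : All (_< N) g) → map toℕ (fromℕs g bounded) ≡ g
  toℕ-fromℕs [] [] = refl
  toℕ-fromℕs (x ∷ w) (x<N ∷ bounded) = cong₂ _∷_ (toℕ-fromℕ< x<N) (toℕ-fromℕs w bounded)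

  map-toℕ-injective : ∀ {m N} (σ τ : Vec (Fin N) m) → map toℕ σ ≡ map toℕ τ → σ ≡ τ
  map-toℕ-injective [] [] _ = refl
  map-toℕ-injective (x ∷ σ) (y ∷ τ) eq with x≡y , σ≡τ ← ∷-injective eq =
    cong₂ _∷_ (toℕ-injective x≡y) (map-toℕ-injective σ τ σ≡τ)

  toPath : ∀ {n} → Vec (Fin n) n → Vec Step n
  toPath σ = decode 0 (map toℕ σ)

  Ψ : ∀ n → Perm n → W n
  Ψ n (σ , isPerm) = toPath σ , decode-valid 0 (map toℕ σ) (permutation-admissible σ isPerm)

  Ψ-injective : ∀ n (σ τ : Perm n) → Ψ n σ ≡ Ψ n τ → σ ≡ τ
  Ψ-injective n (σ , σ-perm) (τ , τ-perm) eq = Σ-≡,≡→≡ (map-toℕ-injective σ τ (begin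
    map toℕ σ                          ≡⟨ encode-decode 0 _ (permutation-admissible σ σ-perm) ⟨
    encode 0 (decode 0 (map toℕ σ))    ≡⟨ cong (encode 0 ∘ proj₁) eq ⟩
    encode 0 (decode 0 (map toℕ τ))    ≡⟨ encode-decode 0 _ (permutation-admissible τ τ-perm) ⟩
    map toℕ τ                          ∎) , T-irrelevant _ _)
    where open ≡-Reasoning

  Ψ-surjective : ∀ n (μ : W n) → Σ (Perm n) (λ σ → Ψ n σ ≡ μ)
  Ψ-surjective n (v , valid) = (σ , isPerm) , Σ-≡,≡→≡ (decoded , T-irrelevant _ _)
    where
      g = encode 0 v
      adm = encode-admissible 0 v valid
      σ = fromℕs g (Admissible.bounded adm)
      isPerm : T (isPermᵇ σ)
      isPerm = subst T (sym (isPermᵇ-pairwise σ))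
        (Distinct⇒pairwiseDistinctᵇ σ (subst Distinct (sym (toℕ-fromℕs g _)) (Admissible.distinct adm)))
      decoded : decode 0 (map toℕ σ) ≡ v
      decoded = trans (cong (decode 0) (toℕ-fromℕs g _)) (decode-encode 0 v valid)

  Ψ-weight : ∀ n (σ : Perm n) → ω (Ψ n σ) ≡ (inv (proj₁ σ) , fix (proj₁ σ) , exc (proj₁ σ) , depth (proj₁ σ))
  Ψ-weight n (σ , isPerm) = begin
    weightFrom 0 (toList v)
      ≡⟨ balanced-permutation adm (subst (λ g′ → Balanced 0 g′ (weightFrom 0 (toList v)))
                                         (encode-decode 0 g adm) (encode-balanced 0 v valid)) ⟩
    (invWord g , fixFrom 0 g , excFrom 0 g , depthFrom 0 g)
      ≡⟨ cong₂ _,_ (sym (inv-invWord σ)) (cong₂ _,_ (sym (sumFin-sumFrom _ 0 σ))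
           (cong₂ _,_ (sym (sumFin-sumFrom _ 0 σ)) (sym (depth-depthFrom σ)))) ⟩
    (inv σ , fix σ , exc σ , depth σ) ∎
    where
      open ≡-Reasoning
      g = map toℕ σ
      adm = permutation-admissible σ isPerm
      v = decode 0 g
      valid = decode-valid 0 g adm

  -- Listing the paths

  extend : ∀ {A : Set} {m} → (A → List (Vec A m)) → List A → List (Vec A (suc m))
  extend f xs = concatMap (λ x → List.map (x ∷_) (f x)) xs

  ∈-extend⁺ : ∀ {A : Set} {m} {f : A → List (Vec A m)} {xs x v} → x ∈ xs → v ∈ f x → (x ∷ v) ∈ extend f xs
  ∈-extend⁺ {f = f} x∈xs v∈fx = ∈-concat⁺′ (∈-map⁺ (_ ∷_) v∈fx) (∈-map⁺ (λ x → List.map (x ∷_) (f x)) x∈xs)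

  ∈-extend⁻ : ∀ {A : Set} {m} {f : A → List (Vec A m)} xs {x v} → (x ∷ v) ∈ extend f xs → x ∈ xs × v ∈ f x
  ∈-extend⁻ {f = f} xs x∷v∈
    with _ , x∷v∈ext , ext∈ ← ∈-concat⁻′ (List.map (λ x → List.map (x ∷_) (f x)) xs) x∷v∈
    with x′ , x′∈xs , refl ← ∈-map⁻ (λ x → List.map (x ∷_) (f x)) ext∈
    with v′ , v′∈fx′ , refl ← ∈-map⁻ (x′ ∷_) x∷v∈ext
    = x′∈xs , v′∈fx′

  extend-unique : ∀ {A : Set} {m} {f : A → List (Vec A m)} {xs} → Unique xs → (∀ x → Unique (f x)) → Unique (extend f xs)
  extend-unique {f = f} xs-unique f-unique = Unique.concat⁺
    (ListAll.map⁺ (ListAll.universal (λ x → Unique.map⁺ (λ eq → proj₂ (∷-injective eq)) (f-unique x)) _))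
    (AllPairs.map⁺ (AllPairs.map disjoint xs-unique))
    where
      disjoint : ∀ {x y} → x ≢ y → ∀ {v} → v ∈ List.map (x ∷_) (f x) × v ∈ List.map (y ∷_) (f y) → ⊥
      disjoint x≢y (v∈x , v∈y)
        with _ , _ , refl ← ∈-map⁻ _ v∈x
        with _ , _ , eq ← ∈-map⁻ _ v∈y
        = x≢y (proj₁ (∷-injective eq))

  kind : Step → ℕ
  kind (U _) = 0
  kind (D _) = 1
  kind (H₁ _) = 2
  kind (H₂ _) = 3
  kind H₃ = 4

  stepsOfKind : ℕ → ℕ → List Step
  stepsOfKind y 0 = List.map U (upTo (suc y))
  stepsOfKind y 1 = List.map D (upTo y)
  stepsOfKind y 2 = List.map H₁ (upTo y)
  stepsOfKind y 3 = List.map H₂ (upTo y)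
  stepsOfKind y 4 = H₃ ∷ []
  stepsOfKind y _ = []

  stepsAt : ℕ → List Step
  stepsAt y = concatMap (stepsOfKind y) (upTo 5)

  kind-stepsOfKind : ∀ y k {st} → st ∈ stepsOfKind y k → kind st ≡ k
  kind-stepsOfKind y 0 st∈ with _ , _ , refl ← ∈-map⁻ U st∈ = refl
  kind-stepsOfKind y 1 st∈ with _ , _ , refl ← ∈-map⁻ D st∈ = refl
  kind-stepsOfKind y 2 st∈ with _ , _ , refl ← ∈-map⁻ H₁ st∈ = refl
  kind-stepsOfKind y 3 st∈ with _ , _ , refl ← ∈-map⁻ H₂ st∈ = refl
  kind-stepsOfKind y 4 (here refl) = refl

  stepsOfKind-unique : ∀ y k → Unique (stepsOfKind y k)
  stepsOfKind-unique y 0 = Unique.map⁺ (λ { refl → refl }) (Unique.upTo⁺ _)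
  stepsOfKind-unique y 1 = Unique.map⁺ (λ { refl → refl }) (Unique.upTo⁺ _)
  stepsOfKind-unique y 2 = Unique.map⁺ (λ { refl → refl }) (Unique.upTo⁺ _)
  stepsOfKind-unique y 3 = Unique.map⁺ (λ { refl → refl }) (Unique.upTo⁺ _)
  stepsOfKind-unique y 4 = ListAll.[] ∷ []
  stepsOfKind-unique y (suc (suc (suc (suc (suc _))))) = []

  stepsAt-unique : ∀ y → Unique (stepsAt y)
  stepsAt-unique y = Unique.concat⁺
    (ListAll.map⁺ {f = stepsOfKind y} (ListAll.universal (stepsOfKind-unique y) (upTo 5)))
    (AllPairs.map⁺ {f = stepsOfKind y} (AllPairs.map disjoint (Unique.upTo⁺ 5)))
    where
      disjoint : ∀ {k k′} → k ≢ k′ → ∀ {st} → st ∈ stepsOfKind y k × st ∈ stepsOfKind y k′ → ⊥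
      disjoint k≢k′ (st∈k , st∈k′) = k≢k′ (trans (sym (kind-stepsOfKind y _ st∈k)) (kind-stepsOfKind y _ st∈k′))

  ∈-stepsAt⁺ : ∀ y st → T (allowed y st) → st ∈ stepsAt y
  ∈-stepsAt⁺ y st ok = ∈-concat⁺′ (in-own-kind st ok) (∈-map⁺ (stepsOfKind y) (∈-upTo⁺ (kind<5 st)))
    where
      kind<5 : ∀ st → kind st < 5
      kind<5 (U _) = s≤s z≤n
      kind<5 (D _) = s≤s (s≤s z≤n)
      kind<5 (H₁ _) = s≤s (s≤s (s≤s z≤n))
      kind<5 (H₂ _) = s≤s (s≤s (s≤s (s≤s z≤n)))
      kind<5 H₃ = ≤-refl
      in-own-kind : ∀ st → T (allowed y st) → st ∈ stepsOfKind y (kind st)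
      in-own-kind (U a) ok = ∈-map⁺ U (∈-upTo⁺ (<ᵇ⇒< a _ ok))
      in-own-kind (D a) ok = ∈-map⁺ D (∈-upTo⁺ (<ᵇ⇒< a _ ok))
      in-own-kind (H₁ a) ok = ∈-map⁺ H₁ (∈-upTo⁺ (<ᵇ⇒< a _ ok))
      in-own-kind (H₂ a) ok = ∈-map⁺ H₂ (∈-upTo⁺ (<ᵇ⇒< a _ ok))
      in-own-kind H₃ _ = here refl

  ∈-stepsAt⁻ : ∀ y {st} → st ∈ stepsAt y → T (allowed y st)
  ∈-stepsAt⁻ y st∈
    with _ , st∈block , block∈ ← ∈-concat⁻′ (List.map (stepsOfKind y) (upTo 5)) st∈
    with k , _ , refl ← ∈-map⁻ (stepsOfKind y) {xs = upTo 5} block∈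
    = allowed-of-kind k st∈block
    where
      allowed-of-kind : ∀ k {st} → st ∈ stepsOfKind y k → T (allowed y st)
      allowed-of-kind 0 st∈ with a , a∈ , refl ← ∈-map⁻ U st∈ = <⇒<ᵇ (∈-upTo⁻ a∈)
      allowed-of-kind 1 st∈ with a , a∈ , refl ← ∈-map⁻ D st∈ = <⇒<ᵇ (∈-upTo⁻ a∈)
      allowed-of-kind 2 st∈ with a , a∈ , refl ← ∈-map⁻ H₁ st∈ = <⇒<ᵇ (∈-upTo⁻ a∈)
      allowed-of-kind 3 st∈ with a , a∈ , refl ← ∈-map⁻ H₂ st∈ = <⇒<ᵇ (∈-upTo⁻ a∈)
      allowed-of-kind 4 (here refl) = _

  paths : ℕ → (m : ℕ) → List (Vec Step m)
  paths y (suc m) = extend (λ st → paths (next y st) m) (stepsAt y)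
  paths zero zero = [] ∷ []
  paths (suc y) zero = []

  ∈-paths⁺ : ∀ {m} y (v : Vec Step m) → T (validFrom y (toList v)) → v ∈ paths y m
  ∈-paths⁺ zero [] _ = here refl
  ∈-paths⁺ y (st ∷ v) valid
    with ok , valid′ ← Equivalence.to T-∧ (subst T (validFrom-∷ y st (toList v)) valid)
    = ∈-extend⁺ (∈-stepsAt⁺ y st ok) (∈-paths⁺ (next y st) v valid′)

  ∈-paths⁻ : ∀ {m} y (v : Vec Step m) → v ∈ paths y m → T (validFrom y (toList v))
  ∈-paths⁻ zero [] _ = _
  ∈-paths⁻ y (st ∷ v) v∈
    with st∈ , v∈′ ← ∈-extend⁻ (stepsAt y) v∈
    = subst T (sym (validFrom-∷ y st (toList v))) (Equivalence.from T-∧ (∈-stepsAt⁻ y st∈ , ∈-paths⁻ (next y st) v v∈′))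

  paths-unique : ∀ y m → Unique (paths y m)
  paths-unique y (suc m) = extend-unique (stepsAt-unique y) (λ st → paths-unique (next y st) m)
  paths-unique zero zero = ListAll.[] ∷ []
  paths-unique (suc y) zero = []

  allWords-unique : ∀ m n → Unique (allWords m n)
  allWords-unique zero n = ListAll.[] ∷ []
  allWords-unique (suc m) n = extend-unique (Unique.allFin⁺ n) (λ _ → allWords-unique m n)

  ∈-allWords : ∀ {m n} (w : Vec (Fin n) m) → w ∈ allWords m n
  ∈-allWords [] = here refl
  ∈-allWords (i ∷ w) = ∈-extend⁺ (∈-allFin i) (∈-allWords w)

  permsList-unique : ∀ n → Unique (permsList n)
  permsList-unique n = Unique.filter⁺ _ (allWords-unique n n)

  ∈-permsList⁺ : ∀ {n} (σ : Vec (Fin n) n) → T (isPermᵇ σ) → σ ∈ permsList n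
  ∈-permsList⁺ σ isPerm = ∈-filter⁺ (λ σ → isPermᵇ σ Bool.≟ true) (∈-allWords σ) (T⇒≡true isPerm)

  ∈-permsList⁻ : ∀ {n} {σ : Vec (Fin n) n} → σ ∈ permsList n → T (isPermᵇ σ)
  ∈-permsList⁻ {n} σ∈ = subst T (sym (proj₂ (∈-filter⁻ (λ σ → isPermᵇ σ Bool.≟ true) {xs = allWords n n} σ∈))) _

  map-unique-on : ∀ {A B : Set} (f : A → B) {xs} → Unique xs →
                  (∀ {x y} → x ∈ xs → y ∈ xs → f x ≡ f y → x ≡ y) → Unique (List.map f xs)
  map-unique-on f [] _ = []
  map-unique-on f (x∉xs ∷ xs-unique) f-inj =
    ListAll.map⁺ (ListAll.tabulate (λ y∈xs fx≡fy → ListAll.lookup x∉xs y∈xs (f-inj (here refl) (there y∈xs) fx≡fy)))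
    ∷ map-unique-on f xs-unique (λ x∈ y∈ → f-inj (there x∈) (there y∈))

  toPath-paths : ∀ n → List.map toPath (permsList n) ↭ paths 0 n
  toPath-paths n = ∼bag⇒↭ (unique∧set⇒bag
    (map-unique-on toPath (permsList-unique n) (λ σ∈ τ∈ eq →
      cong proj₁ (Ψ-injective n (_ , ∈-permsList⁻ σ∈) (_ , ∈-permsList⁻ τ∈) (Σ-≡,≡→≡ (eq , T-irrelevant _ _)))))
    (paths-unique 0 n)
    (mk⇔ to from))
    where
      to : ∀ {v} → v ∈ List.map toPath (permsList n) → v ∈ paths 0 n
      to v∈ with σ , σ∈ , refl ← ∈-map⁻ toPath v∈ = ∈-paths⁺ 0 (toPath σ) (proj₂ (Ψ n (σ , ∈-permsList⁻ σ∈)))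
      from : ∀ {v} → v ∈ paths 0 n → v ∈ List.map toPath (permsList n)
      from {v} v∈ with (σ , isPerm) , Ψσ≡v ← Ψ-surjective n (v , ∈-paths⁻ 0 v v∈) =
        subst (_∈ List.map toPath (permsList n)) (cong proj₁ Ψσ≡v) (∈-map⁺ toPath (∈-permsList⁺ σ isPerm))

module GeneratingFunction (R : CommutativeSemiring 0ℓ 0ℓ) where

  open Bijection
    using (≡ᵇ-refl; ≢⇒≡ᵇ-false; <⇒<ᵇ-true; ≤⇒<ᵇ-false; next; stepWeight; weightFrom-∷; extend; stepsAt;
           stepsOfKind; paths; toPath; toPath-paths; Ψ-weight; ∈-permsList⁻)
  open import Data.Nat.Base as ℕ using (ℕ; zero; suc; pred; _∸_; _<ᵇ_; _≡ᵇ_; z≤n; s≤s)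
  import Data.Nat.Properties as ℕ
  open import Data.Bool.Base using (Bool; true; false; if_then_else_)
  open import Data.Vec.Base using (Vec; []; _∷_; _∷ʳ_; toList)
  open import Data.List.Base as List using (List; []; _∷_; _++_; concatMap; upTo; applyUpTo)
  open import Data.List.Membership.Propositional using (_∈_)
  open import Data.List.Relation.Unary.Any using (here; there)
  open import Data.List.Relation.Binary.Permutation.Propositional as ↭ using (_↭_)
  open import Data.Product.Base using (_,_)
  open import Data.Sum.Base using (_⊎_; inj₁; inj₂)
  open import Function.Base using (_∘_)
  open import Relation.Binary.PropositionalEquality as ≡ using (_≡_)

  open CommutativeSemiring R
  open import Relation.Binary.Reasoning.Setoid setoid
  open import Algebra.Properties.CommutativeSemigroup +-commutativeSemigroup using (interchange; x∙yz≈y∙xz)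
  import Algebra.Properties.CommutativeSemigroup *-commutativeSemigroup as *-Semigroup
  open import Algebra.Solver.Ring.NaturalCoefficients.Default R using (solve; _:+_; _:*_; _:=_; con)

  ΣL-cong : ∀ {A : Set} (xs : List A) {f g : A → Carrier} → (∀ {x} → x ∈ xs → f x ≈ g x) → ΣL R xs f ≈ ΣL R xs g
  ΣL-cong [] _ = refl
  ΣL-cong (x ∷ xs) f≈g = +-cong (f≈g (here ≡.refl)) (ΣL-cong xs (f≈g ∘ there))

  ΣL-↭ : ∀ {A : Set} {xs ys : List A} (f : A → Carrier) → xs ↭ ys → ΣL R xs f ≈ ΣL R ys f
  ΣL-↭ f ↭.refl = refl
  ΣL-↭ f (↭.prep x xs↭ys) = +-congˡ (ΣL-↭ f xs↭ys)
  ΣL-↭ f (↭.swap x y xs↭ys) = trans (+-congˡ (+-congˡ (ΣL-↭ f xs↭ys))) (x∙yz≈y∙xz (f x) (f y) _)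
  ΣL-↭ f (↭.trans xs↭ys ys↭zs) = trans (ΣL-↭ f xs↭ys) (ΣL-↭ f ys↭zs)

  ΣL-map : ∀ {A B : Set} (h : A → B) (xs : List A) (f : B → Carrier) → ΣL R (List.map h xs) f ≡ ΣL R xs (f ∘ h)
  ΣL-map h [] f = ≡.refl
  ΣL-map h (x ∷ xs) f = ≡.cong (f (h x) +_) (ΣL-map h xs f)

  ΣL-++ : ∀ {A : Set} (xs ys : List A) (f : A → Carrier) → ΣL R (xs ++ ys) f ≈ ΣL R xs f + ΣL R ys f
  ΣL-++ [] ys f = sym (+-identityˡ _)
  ΣL-++ (x ∷ xs) ys f = trans (+-congˡ (ΣL-++ xs ys f)) (sym (+-assoc _ _ _))

  ΣL-concatMap : ∀ {A B : Set} (g : A → List B) (xs : List A) (f : B → Carrier) →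
                 ΣL R (concatMap g xs) f ≈ ΣL R xs (λ x → ΣL R (g x) f)
  ΣL-concatMap g [] f = refl
  ΣL-concatMap g (x ∷ xs) f = trans (ΣL-++ (g x) (concatMap g xs) f) (+-congˡ (ΣL-concatMap g xs f))

  ΣL-*ˡ : ∀ {A : Set} c (xs : List A) (f : A → Carrier) → c * ΣL R xs f ≈ ΣL R xs (λ x → c * f x)
  ΣL-*ˡ c [] f = zeroʳ c
  ΣL-*ˡ c (x ∷ xs) f = trans (distribˡ c (f x) _) (+-congˡ (ΣL-*ˡ c xs f))

  ΣR-cong : ∀ n {f g : ℕ → Carrier} → (∀ {a} → a ℕ.< n → f a ≈ g a) → ΣR R n f ≈ ΣR R n g
  ΣR-cong zero _ = refl
  ΣR-cong (suc n) f≈g = +-cong (ΣR-cong n (f≈g ∘ ℕ.m<n⇒m<1+n)) (f≈g ℕ.≤-refl)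

  ΣR-+ : ∀ n (f g : ℕ → Carrier) → ΣR R n (λ a → f a + g a) ≈ ΣR R n f + ΣR R n g
  ΣR-+ zero f g = sym (+-identityˡ 0#)
  ΣR-+ (suc n) f g = trans (+-congʳ (ΣR-+ n f g)) (interchange _ _ (f n) (g n))

  ΣR-*ˡ : ∀ n c (f : ℕ → Carrier) → c * ΣR R n f ≈ ΣR R n (λ a → c * f a)
  ΣR-*ˡ zero c f = zeroʳ c
  ΣR-*ˡ (suc n) c f = trans (distribˡ c _ _) (+-congʳ (ΣR-*ˡ n c f))

  ΣR-*ʳ : ∀ n c (f : ℕ → Carrier) → ΣR R n f * c ≈ ΣR R n (λ a → f a * c)
  ΣR-*ʳ zero c f = zeroˡ c
  ΣR-*ʳ (suc n) c f = trans (distribʳ c _ _) (+-congʳ (ΣR-*ʳ n c f))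

  ΣR-zero : ∀ n → ΣR R n (λ _ → 0#) ≈ 0#
  ΣR-zero zero = refl
  ΣR-zero (suc n) = trans (+-identityʳ _) (ΣR-zero n)

  ΣR-shift : ∀ n (f : ℕ → Carrier) → ΣR R (suc n) f ≈ f 0 + ΣR R n (f ∘ suc)
  ΣR-shift zero f = trans (+-identityˡ _) (sym (+-identityʳ _))
  ΣR-shift (suc n) f = trans (+-congʳ (ΣR-shift n f)) (+-assoc _ _ _)

  ΣL-applyUpTo : ∀ n (h : ℕ → ℕ) (f : ℕ → Carrier) → ΣL R (applyUpTo h n) f ≈ ΣR R n (f ∘ h)
  ΣL-applyUpTo zero h f = refl
  ΣL-applyUpTo (suc n) h f = trans (+-congˡ (ΣL-applyUpTo n (h ∘ suc) f)) (sym (ΣR-shift n (f ∘ h)))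

  ΣL-extend : ∀ {A : Set} {m} (f : A → List (Vec A m)) xs (F : Vec A (suc m) → Carrier) →
              ΣL R (extend f xs) F ≈ ΣL R xs (λ x → ΣL R (f x) (F ∘ (x ∷_)))
  ΣL-extend f xs F = trans (ΣL-concatMap _ xs F) (ΣL-cong xs (λ {x} _ → reflexive (ΣL-map (x ∷_) (f x) F)))

  ΣL-upTo-*ʳ : ∀ n (f : ℕ → Carrier) c → ΣL R (upTo n) (λ a → f a * c) ≈ ΣR R n f * c
  ΣL-upTo-*ʳ n f c = trans (ΣL-applyUpTo n (λ a → a) (λ a → f a * c)) (sym (ΣR-*ʳ n c f))

  pow-+ : ∀ x m n → pow R x (m ℕ.+ n) ≈ pow R x m * pow R x n
  pow-+ x zero n = sym (*-identityˡ _)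
  pow-+ x (suc m) n = trans (*-congˡ (pow-+ x m n)) (sym (*-assoc _ _ _))

  pow-* : ∀ x y n → pow R (x * y) n ≈ pow R x n * pow R y n
  pow-* x y zero = sym (*-identityˡ 1#)
  pow-* x y (suc n) = trans (*-congˡ (pow-* x y n)) (*-Semigroup.interchange x y _ _)

  get-∷ʳ-< : ∀ {k} (v : Vec Carrier k) x {i} → i ℕ.< k → get R (v ∷ʳ x) i ≡ get R v i
  get-∷ʳ-< (y ∷ v) x {zero} _ = ≡.refl
  get-∷ʳ-< (y ∷ v) x {suc i} (s≤s i<k) = get-∷ʳ-< v x i<k

  get-∷ʳ : ∀ {k} (v : Vec Carrier k) x → get R (v ∷ʳ x) k ≡ x
  get-∷ʳ [] x = ≡.refl
  get-∷ʳ (y ∷ v) x = get-∷ʳ v x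

  module ContinuedFraction (γ λ′ : ℕ → Carrier) where

    coefficient : ℕ → ℕ → Carrier
    coefficient h i = get R (jtab R γ λ′ i h) i

    jtab-stable : ∀ n h {i} → i ℕ.≤ n → get R (jtab R γ λ′ n h) i ≡ coefficient h i
    jtab-stable n h i≤n with ℕ.m≤n⇒m<n∨m≡n i≤n
    ... | inj₂ ≡.refl = ≡.refl
    jtab-stable (suc n) h {i} _ | inj₁ i<1+n =
      ≡.trans (get-∷ʳ-< (jtab R γ λ′ n h) _ i<1+n) (jtab-stable n h (ℕ.≤-pred i<1+n))

    coefficient-suc : ∀ n h → coefficient h (suc n) ≈
      γ h * coefficient h n + λ′ (suc h) * ΣR R n (λ a → coefficient (suc h) a * coefficient h (n ∸ suc a))
    coefficient-suc n h = begin
      coefficient h (suc n)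
        ≡⟨ get-∷ʳ (jtab R γ λ′ n h) _ ⟩
      γ h * get R (jtab R γ λ′ n h) n
        + λ′ (suc h) * ΣR R n (λ a → get R (jtab R γ λ′ n (suc h)) a * get R (jtab R γ λ′ n h) (n ∸ 1 ∸ a))
        ≈⟨ +-cong (*-congˡ (reflexive (jtab-stable n h ℕ.≤-refl)))
                  (*-congˡ (ΣR-cong n (λ {a} a<n → *-cong (reflexive (jtab-stable n (suc h) (ℕ.<⇒≤ a<n)))
                    (reflexive (≡.trans (jtab-stable n h (ℕ.≤-trans (ℕ.m∸n≤m (n ∸ 1) a) (ℕ.m∸n≤m n 1)))
                                        (≡.cong (coefficient h) (ℕ.∸-+-assoc n 1 a))))))) ⟩
      γ h * coefficient h n + λ′ (suc h) * ΣR R n (λ a → coefficient (suc h) a * coefficient h (n ∸ suc a)) ∎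

  module PathWeights (q p s t : Carrier) where

    mono : Mono → Carrier
    mono (i , j , k , ℓ) = pow R q i * pow R p j * pow R s k * pow R t ℓ

    mono-⊕ : ∀ μ ν → mono (μ ⊕ ν) ≈ mono μ * mono ν
    mono-⊕ (i , j , k , ℓ) (i′ , j′ , k′ , ℓ′) = begin
      pow R q (i ℕ.+ i′) * pow R p (j ℕ.+ j′) * pow R s (k ℕ.+ k′) * pow R t (ℓ ℕ.+ ℓ′)
        ≈⟨ *-cong (*-cong (*-cong (pow-+ q i i′) (pow-+ p j j′)) (pow-+ s k k′)) (pow-+ t ℓ ℓ′) ⟩
      (pow R q i * pow R q i′) * (pow R p j * pow R p j′) * (pow R s k * pow R s k′) * (pow R t ℓ * pow R t ℓ′)
        ≈⟨ solve 8 (λ a a′ b b′ c c′ d d′ → (a :* a′) :* (b :* b′) :* (c :* c′) :* (d :* d′) :=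
                     (a :* b :* c :* d) :* (a′ :* b′ :* c′ :* d′)) refl
                   (pow R q i) (pow R q i′) (pow R p j) (pow R p j′) (pow R s k) (pow R s k′) (pow R t ℓ) (pow R t ℓ′) ⟩
      mono (i , j , k , ℓ) * mono (i′ , j′ , k′ , ℓ′) ∎

    pathSum : ℕ → ℕ → Carrier
    pathSum y m = ΣL R (paths y m) (λ v → mono (weightFrom y (toList v)))

    upSum downSum levelSum : ℕ → Carrier
    upSum h = ΣR R h (λ a → mono (ωU h a))
    downSum h = ΣR R h (λ a → mono (ωD h a))
    levelSum h = ΣR R h (λ a → mono (ωH₁ h a)) + ΣR R h (λ a → mono (ωH₂ h a)) + mono (ωH₃ h)

    stepsAt-sum : ∀ y (X : ℕ → Carrier) →
      ΣL R (stepsAt y) (λ st → mono (stepWeight y st) * X (next y st)) ≈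
      upSum (suc y) * X (suc y) + downSum y * X (pred y) + levelSum y * X y
    stepsAt-sum y X = begin
      ΣL R (stepsAt y) F
        ≈⟨ ΣL-concatMap (stepsOfKind y) (upTo 5) F ⟩
      kindSum U (suc y) + (kindSum D y + (kindSum H₁ y + (kindSum H₂ y + ((F H₃ + 0#) + 0#))))
        ≈⟨ +-cong (block U (suc y) (λ _ → ≡.refl)) (+-cong (block D y (λ _ → ≡.refl))
             (+-cong (block H₁ y (λ _ → ≡.refl)) (+-congʳ (block H₂ y (λ _ → ≡.refl))))) ⟩
      upSum (suc y) * X (suc y) + (downSum y * X (pred y) + (h₁ * X y + (h₂ * X y + ((mono (ωH₃ y) * X y + 0#) + 0#))))
        ≈⟨ solve 6 (λ u d a b c x → u :+ (d :+ (a :* x :+ (b :* x :+ ((c :* x :+ con 0) :+ con 0)))) :=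
                                      u :+ d :+ (a :+ b :+ c) :* x)
                 refl (upSum (suc y) * X (suc y)) (downSum y * X (pred y)) h₁ h₂ (mono (ωH₃ y)) (X y) ⟩
      upSum (suc y) * X (suc y) + downSum y * X (pred y) + levelSum y * X y ∎
      where
        F = λ st → mono (stepWeight y st) * X (next y st)
        kindSum : (ℕ → Step) → ℕ → Carrier
        kindSum C n = ΣL R (List.map C (upTo n)) F
        block : ∀ C n {f : ℕ → Carrier} {c} → (∀ a → F (C a) ≡ f a * c) → kindSum C n ≈ ΣR R n f * c
        block C n {f} {c} F∘C≡ = trans (reflexive (ΣL-map C (upTo n) F))
          (trans (ΣL-cong (upTo n) (λ {a} _ → reflexive (F∘C≡ a))) (ΣL-upTo-*ʳ n f c))
        h₁ = ΣR R y (λ a → mono (ωH₁ y a))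
        h₂ = ΣR R y (λ a → mono (ωH₂ y a))

    pathSum-suc : ∀ y m → pathSum y (suc m) ≈
      upSum (suc y) * pathSum (suc y) m + downSum y * pathSum (pred y) m + levelSum y * pathSum y m
    pathSum-suc y m = begin
      pathSum y (suc m)
        ≈⟨ ΣL-extend (λ st → paths (next y st) m) (stepsAt y) _ ⟩
      ΣL R (stepsAt y) (λ st → ΣL R (paths (next y st) m) (λ v → mono (weightFrom y (st ∷ toList v))))
        ≈⟨ ΣL-cong (stepsAt y) (λ {st} _ → trans (ΣL-cong (paths (next y st) m) (λ {v} _ → first-step st v))
                                             (sym (ΣL-*ˡ _ (paths (next y st) m) _))) ⟩
      ΣL R (stepsAt y) (λ st → mono (stepWeight y st) * pathSum (next y st) m)
        ≈⟨ stepsAt-sum y (λ y′ → pathSum y′ m) ⟩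
      upSum (suc y) * pathSum (suc y) m + downSum y * pathSum (pred y) m + levelSum y * pathSum y m ∎
      where
        first-step : ∀ st {m′} (v : Vec Step m′) →
                     mono (weightFrom y (st ∷ toList v)) ≈ mono (stepWeight y st) * mono (weightFrom (next y st) (toList v))
        first-step st v = trans (reflexive (≡.cong mono (weightFrom-∷ y st (toList v))))
                                (mono-⊕ (stepWeight y st) (weightFrom (next y st) (toList v)))

    -- The weight of the paths of length m from height y to height h that never go below h.
    pathsAbove : ℕ → ℕ → ℕ → Carrier
    pathsAbove h y zero = if y ≡ᵇ h then 1# else 0#
    pathsAbove h y (suc m) = upSum (suc y) * pathsAbove h (suc y) m
                           + (if h <ᵇ y then downSum y * pathsAbove h (pred y) m else 0#)
                           + levelSum y * pathsAbove h y m

    pathSum-pathsAbove : ∀ y m → pathSum y m ≈ pathsAbove 0 y m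
    pathSum-pathsAbove zero zero = trans (+-identityʳ _) (trans (*-identityʳ _) (trans (*-identityʳ _) (*-identityʳ _)))
    pathSum-pathsAbove (suc y) zero = refl
    pathSum-pathsAbove y (suc m) = trans (pathSum-suc y m)
      (+-cong (+-cong (*-congˡ (pathSum-pathsAbove (suc y) m)) (down y)) (*-congˡ (pathSum-pathsAbove y m)))
      where
        down : ∀ y → downSum y * pathSum (pred y) m ≈ (if 0 <ᵇ y then downSum y * pathsAbove 0 (pred y) m else 0#)
        down zero = zeroˡ _
        down (suc y) = *-congˡ (pathSum-pathsAbove y m)

    returnConvolution : ℕ → ℕ → ℕ → Carrier
    returnConvolution h y m = ΣR R m (λ a → pathsAbove (suc h) y a * pathsAbove h h (m ∸ suc a))

    returnConvolution-suc : ∀ h y m → ΣR R m (λ a → pathsAbove (suc h) y (suc a) * pathsAbove h h (m ∸ suc a)) ≈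
      upSum (suc y) * returnConvolution h (suc y) m
      + (if suc h <ᵇ y then downSum y * returnConvolution h (pred y) m else 0#)
      + levelSum y * returnConvolution h y m
    returnConvolution-suc h y m = begin
      ΣR R m (λ a → (u * E′ (suc y) a + Dₐ a + g * E′ y a) * Z a)
        ≈⟨ ΣR-cong m (λ {a} _ → distribute (E′ (suc y) a) (Dₐ a) (E′ y a) (Z a)) ⟩
      ΣR R m (λ a → u * (E′ (suc y) a * Z a) + Dₐ a * Z a + g * (E′ y a * Z a))
        ≈⟨ trans (ΣR-+ m _ _) (+-congʳ (ΣR-+ m _ _)) ⟩
      ΣR R m (λ a → u * (E′ (suc y) a * Z a)) + ΣR R m (λ a → Dₐ a * Z a) + ΣR R m (λ a → g * (E′ y a * Z a))
        ≈⟨ +-cong (+-cong (sym (ΣR-*ˡ m u _)) (down (suc h <ᵇ y))) (sym (ΣR-*ˡ m g _)) ⟩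
      u * returnConvolution h (suc y) m + (if suc h <ᵇ y then downSum y * returnConvolution h (pred y) m else 0#)
        + g * returnConvolution h y m ∎
      where
        u = upSum (suc y)
        g = levelSum y
        E′ = pathsAbove (suc h)
        Z = λ a → pathsAbove h h (m ∸ suc a)
        Dₐ = λ a → if suc h <ᵇ y then downSum y * E′ (pred y) a else 0#
        distribute : ∀ e₁ d e₂ z → (u * e₁ + d + g * e₂) * z ≈ u * (e₁ * z) + d * z + g * (e₂ * z)
        distribute = solve 6 (λ u g e₁ d e₂ z → (u :* e₁ :+ d :+ g :* e₂) :* z :=
                                                u :* (e₁ :* z) :+ d :* z :+ g :* (e₂ :* z)) refl u g
        down : ∀ b → ΣR R m (λ a → (if b then downSum y * E′ (pred y) a else 0#) * Z a) ≈
                     (if b then downSum y * returnConvolution h (pred y) m else 0#)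
        down true = trans (ΣR-cong m (λ _ → *-assoc _ _ _)) (sym (ΣR-*ˡ m (downSum y) _))
        down false = trans (ΣR-cong m (λ _ → zeroˡ _)) (ΣR-zero m)

    -- Cut the path at its first down step from height h + 1 to h.
    first-passage : ∀ m h y → h ℕ.< y → pathsAbove h y m ≈ downSum (suc h) * returnConvolution h y m
    first-passage zero h y h<y rewrite ≢⇒≡ᵇ-false (ℕ.>⇒≢ h<y) = sym (zeroʳ _)
    first-passage (suc m) h y h<y rewrite <⇒<ᵇ-true h<y = begin
      u * E (suc y) m + downSum y * E (pred y) m + g * E y m
        ≈⟨ by-height (ℕ.m≤n⇒m<n∨m≡n h<y) ⟩
      d * (E′ y 0 * E h m + (u * C (suc y) m + (if suc h <ᵇ y then downSum y * C (pred y) m else 0#) + g * C y m))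
        ≈⟨ *-congˡ (+-congˡ (sym (returnConvolution-suc h y m))) ⟩
      d * (E′ y 0 * E h m + ΣR R m (λ a → E′ y (suc a) * E h (m ∸ suc a)))
        ≈⟨ *-congˡ (sym (ΣR-shift m _)) ⟩
      d * C y (suc m) ∎
      where
        u = upSum (suc y)
        g = levelSum y
        d = downSum (suc h)
        E = pathsAbove h
        E′ = pathsAbove (suc h)
        C = returnConvolution h
        up = *-congˡ (first-passage m h (suc y) (ℕ.m<n⇒m<1+n h<y))
        level = *-congˡ (first-passage m h y h<y)
        by-height : suc h ℕ.< y ⊎ suc h ≡ y →
          u * E (suc y) m + downSum y * E (pred y) m + g * E y m ≈
          d * (E′ y 0 * E h m + (u * C (suc y) m + (if suc h <ᵇ y then downSum y * C (pred y) m else 0#) + g * C y m))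
        by-height (inj₂ ≡.refl) rewrite ≡ᵇ-refl (suc h) | ≤⇒<ᵇ-false (ℕ.≤-refl {suc h}) = begin
          u * E (suc y) m + d * E h m + g * E y m
            ≈⟨ +-cong (+-congʳ up) level ⟩
          u * (d * C (suc y) m) + d * E h m + g * (d * C y m)
            ≈⟨ solve 6 (λ u d cu e g cy → u :* (d :* cu) :+ d :* e :+ g :* (d :* cy) :=
                                       d :* (con 1 :* e :+ (u :* cu :+ con 0 :+ g :* cy))) refl u d (C (suc y) m) (E h m) g (C y m) ⟩
          d * (1# * E h m + (u * C (suc y) m + 0# + g * C y m)) ∎
        by-height (inj₁ 1+h<y) rewrite ≢⇒≡ᵇ-false (ℕ.>⇒≢ 1+h<y) | <⇒<ᵇ-true 1+h<y = begin
          u * E (suc y) m + downSum y * E (pred y) m + g * E y m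
            ≈⟨ +-cong (+-cong up (*-congˡ (first-passage m h (pred y) (ℕ.pred-mono-< 1+h<y)))) level ⟩
          u * (d * C (suc y) m) + downSum y * (d * C (pred y) m) + g * (d * C y m)
            ≈⟨ solve 8 (λ u d cu e dy cp g cy → u :* (d :* cu) :+ dy :* (d :* cp) :+ g :* (d :* cy) :=
                                             d :* (con 0 :* e :+ (u :* cu :+ dy :* cp :+ g :* cy))) refl
                     u d (C (suc y) m) (E h m) (downSum y) (C (pred y) m) g (C y m) ⟩
          d * (0# * E h m + (u * C (suc y) m + downSum y * C (pred y) m + g * C y m)) ∎

    upSum-qint : ∀ h → upSum h ≈ qint R q h * (s * pow R t (2 ℕ.* h ∸ 1))
    upSum-qint h = trans (ΣR-cong h (λ {a} _ → solve 3 (λ x y z → x :* con 1 :* (y :* con 1) :* z := x :* (y :* z)) refl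
                                                       (pow R q a) s (pow R t (2 ℕ.* h ∸ 1))))
                         (sym (ΣR-*ʳ h _ (pow R q)))

    downSum-qint : ∀ h → downSum h ≈ pow R q (2 ℕ.* h ∸ 1) * qint R q h
    downSum-qint h = trans (ΣR-cong h (λ {a} _ → trans (*-identityʳ _) (trans (*-identityʳ _) (trans (*-identityʳ _)
                                                    (pow-+ q (2 ℕ.* h ∸ 1) a)))))
                           (sym (ΣR-*ˡ h _ (pow R q)))

    up*down≈λ : ∀ h → upSum h * downSum h ≈ λseq R q p s t h
    up*down≈λ h = begin
      upSum h * downSum h
        ≈⟨ *-cong (upSum-qint h) (downSum-qint h) ⟩
      qint R q h * (s * pow R t k) * (pow R q k * qint R q h)
        ≈⟨ solve 4 (λ Q S T P → Q :* (S :* T) :* (P :* Q) := S :* (Q :* Q) :* (P :* T))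
                   refl (qint R q h) s (pow R t k) (pow R q k) ⟩
      s * (qint R q h * qint R q h) * (pow R q k * pow R t k)
        ≈⟨ *-congˡ (sym (pow-* q t k)) ⟩
      λseq R q p s t h ∎
      where k = 2 ℕ.* h ∸ 1

    levelSum≈γ : ∀ h → levelSum h ≈ γseq R q p s t h
    levelSum≈γ h = begin
      levelSum h
        ≈⟨ +-cong (+-cong (trans (ΣR-cong h (λ {a} _ → H₁-weight a)) (sym (ΣR-*ʳ h _ (pow R q))))
                          (trans (ΣR-cong h (λ {a} _ → H₂-weight a)) (sym (ΣR-*ʳ h _ (pow R q))))) H₃-weight ⟩
      qint R q h * (Qh * s * Th) + qint R q h * (Qh * Th) + Qh * (Qh * 1#) * (p * 1#) * 1# * Th
        ≈⟨ solve 5 (λ Q Qh Th S P → Q :* (Qh :* S :* Th) :+ Q :* (Qh :* Th) :+ Qh :* (Qh :* con 1) :* (P :* con 1) :* con 1 :* Th :=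
                                    ((con 1 :+ S) :* Q :+ P :* Qh) :* (Qh :* Th)) refl (qint R q h) Qh Th s p ⟩
      ((1# + s) * qint R q h + p * Qh) * (Qh * Th)
        ≈⟨ *-congˡ (sym (pow-* q t h)) ⟩
      γseq R q p s t h ∎
      where
        Qh = pow R q h
        Th = pow R t h
        H₁-weight : ∀ a → mono (ωH₁ h a) ≈ pow R q a * (Qh * s * Th)
        H₁-weight a = trans (*-congʳ (*-congʳ (*-congʳ (pow-+ q h a))))
          (solve 4 (λ Qh Qa S Th → Qh :* Qa :* con 1 :* (S :* con 1) :* Th := Qa :* (Qh :* S :* Th)) refl Qh (pow R q a) s Th)
        H₂-weight : ∀ a → mono (ωH₂ h a) ≈ pow R q a * (Qh * Th)
        H₂-weight a = trans (*-congʳ (*-congʳ (*-congʳ (pow-+ q h a))))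
          (solve 3 (λ Qh Qa Th → Qh :* Qa :* con 1 :* con 1 :* Th := Qa :* (Qh :* Th)) refl Qh (pow R q a) Th)
        H₃-weight : mono (ωH₃ h) ≈ Qh * (Qh * 1#) * (p * 1#) * 1# * Th
        H₃-weight = *-congʳ (*-congʳ (*-congʳ (trans (pow-+ q h (h ℕ.+ 0)) (*-congˡ (pow-+ q h 0)))))

    open ContinuedFraction (γseq R q p s t) (λseq R q p s t)

    coefficient-pathsAbove : ∀ N {n} h → n ℕ.≤ N → coefficient h n ≈ pathsAbove h h n
    coefficient-pathsAbove N {zero} h _ rewrite ≡ᵇ-refl h = refl
    coefficient-pathsAbove (suc N) {suc n} h (s≤s n≤N) = begin
      coefficient h (suc n)
        ≈⟨ coefficient-suc n h ⟩
      γseq R q p s t h * coefficient h n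
        + λseq R q p s t (suc h) * ΣR R n (λ a → coefficient (suc h) a * coefficient h (n ∸ suc a))
        ≈⟨ +-cong (*-cong (sym (levelSum≈γ h)) (coefficient-pathsAbove N h n≤N))
                  (*-cong (sym (up*down≈λ (suc h))) (ΣR-cong n (λ {a} a<n →
                    *-cong (coefficient-pathsAbove N (suc h) (ℕ.≤-trans (ℕ.<⇒≤ a<n) n≤N))
                           (coefficient-pathsAbove N h (ℕ.≤-trans (ℕ.m∸n≤m n (suc a)) n≤N))))) ⟩
      levelSum h * pathsAbove h h n + upSum (suc h) * downSum (suc h) * returnConvolution h (suc h) n
        ≈⟨ +-congˡ (trans (*-assoc _ _ _) (*-congˡ (sym (first-passage n h (suc h) ℕ.≤-refl)))) ⟩
      levelSum h * pathsAbove h h n + upSum (suc h) * pathsAbove h (suc h) n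
        ≈⟨ trans (+-comm _ _) (+-congʳ (sym (+-identityʳ _))) ⟩
      upSum (suc h) * pathsAbove h (suc h) n + 0# + levelSum h * pathsAbove h h n
        ≡⟨ ≡.cong (λ b → upSum (suc h) * pathsAbove h (suc h) n + (if b then downSum h * pathsAbove h (pred h) n else 0#)
                          + levelSum h * pathsAbove h h n) (≡.sym (≤⇒<ᵇ-false (ℕ.≤-refl {h}))) ⟩
      pathsAbove h h (suc n) ∎

    genPoly-pathSum : ∀ n → genPoly R q p s t n ≈ pathSum 0 n
    genPoly-pathSum n = begin
      genPoly R q p s t n
        ≈⟨ ΣL-cong (permsList n) (λ {σ} σ∈ →
             reflexive (≡.cong mono (≡.sym (Ψ-weight n (σ , ∈-permsList⁻ σ∈))))) ⟩
      ΣL R (permsList n) (λ σ → mono (weightFrom 0 (toList (toPath σ))))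
        ≡⟨ ΣL-map toPath (permsList n) _ ⟨
      ΣL R (List.map toPath (permsList n)) (λ v → mono (weightFrom 0 (toList v)))
        ≈⟨ ΣL-↭ _ (toPath-paths n) ⟩
      pathSum 0 n ∎

    genPoly≈JFrac : ∀ n → genPoly R q p s t n ≈ JFrac R (γseq R q p s t) (λseq R q p s t) n
    genPoly≈JFrac n = trans (genPoly-pathSum n) (trans (pathSum-pathsAbove 0 n) (sym (coefficient-pathsAbove n 0 ℕ.≤-refl)))

theorem1p1 :
  ((n : ℕ) → Σ (Perm n → W n) (λ Ψ →
      ((σ τ : Perm n) → Ψ σ ≡ Ψ τ → σ ≡ τ)
    × ((μ : W n) → Σ (Perm n) (λ σ → Ψ σ ≡ μ))
    × ((σ : Perm n) →
         ω (Ψ σ) ≡ (inv (proj₁ σ) , fix (proj₁ σ) , exc (proj₁ σ) , depth (proj₁ σ)))))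
  × ((R : CommutativeSemiring 0ℓ 0ℓ) → (q p s t : CommutativeSemiring.Carrier R) → (n : ℕ) →
      CommutativeSemiring._≈_ R
        (genPoly R q p s t n)
        (JFrac R (γseq R q p s t) (λseq R q p s t) n))
theorem1p1 = (λ n → Ψ n , Ψ-injective n , Ψ-surjective n , Ψ-weight n) , genPoly≈JFrac
  where
    open Bijection using (Ψ; Ψ-injective; Ψ-surjective; Ψ-weight)
    open GeneratingFunction.PathWeights using (genPoly≈JFrac)
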